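{- For every $r \ge 2$, $n \ge 2r$ and $1 \le s \le \frac{n-2r+2}{2}$, we have $W(G_{n,r,s})=\binom{n}{2}+(r-1)^2n -r(r-1)^2$ and $W(D_{n,r,s})=2\binom{n}{2}+(r-1)^2 n-4 \binom{r}{3}$.
   Context: For a graph, $W(G)=\sum_{\{u,v\}} d(u,v)$ over unordered pairs; for a digraph, $W(D)=\sum_{(u,v)} d(u,v)$ over ordered pairs, with $d$ the (directed) shortest path distance. $G_{n,r,s}$ is obtained from a cycle $C_{2r}$ by replacing two consecutive vertices $a,b$ by cliques $K_s$ and $K_{n-2r+2-s}$ respectively, each vertex of the clique replacing $a$ (resp. $b$) being adjacent to the other cycle neighbour of $a$ (resp. $b$), and all vertices of the two cliques being mutually adjacent. $D_{2r,r,1}$ is the digraph on vertices $v_1,\dots,v_r,w_1,\dots,w_r$ with, for $i\neq j$, an arc $v_i\to v_j$ iff $j\le i+1$, an arc $w_i\to w_j$ iff $j\le i+1$, and arcs $v_i\to w_1$ and $w_i \to v_1$ for all $i$. $D_{n,r,s}$ is obtained from $D_{2r,r,1}$ by replacing $v_1$ by a bidirected clique on $s$ vertices and $w_1$ by a bidirected clique on $n-2r+2-s$ vertices, each new vertex inheriting (in the same directions) all arcs of the vertex it replaces, with all arcs in both directions between the two cliques. -}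

module Defs where

open import Data.Nat using (ℕ; zero; suc; _+_; _*_; _∸_; _<ᵇ_; _≡ᵇ_)
open import Data.Bool using (Bool; true; false; _∧_; _∨_; not; if_then_else_)
open import Data.Fin using (Fin; toℕ)
open import Data.Fin.Properties using (_≟_)
open import Data.List using (List; map)
open import Data.Nat.ListAction using (sum)
open import Data.Bool.ListAction using (any)
open import Data.List using () renaming (allFin to allFinL)
open import Relation.Nullary.Decidable using (⌊_⌋)

Rel : ℕ → Set
Rel n = Fin n → Fin n → Bool

_≤ᵇ_ : ℕ → ℕ → Bool
a ≤ᵇ b = a <ᵇ suc b

reach : ∀ {n} → Rel n → ℕ → Fin n → Fin n → Bool
reach adj zero    u v = ⌊ u ≟ v ⌋
reach {n} adj (suc k) u v =
  reach adj k u v ∨ any (λ w → reach adj k u w ∧ adj w v) (allFinL n)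

-- shortest-path distance: the least k with a walk of length ≤ k from u to v,
-- searched for k = 0, 1, …, n (returns n+1 if v is unreachable from u;
-- this never happens for the strongly connected graphs considered below)
distSearch : ∀ {n} → Rel n → Fin n → Fin n → ℕ → ℕ → ℕ
distSearch adj u v k zero = k
distSearch adj u v k (suc fuel) =
  if reach adj k u v then k else distSearch adj u v (suc k) fuel

dist : ∀ {n} → Rel n → Fin n → Fin n → ℕ
dist {n} adj u v = distSearch adj u v 0 (suc n)

WienerG : ∀ {n} → Rel n → ℕ
WienerG {n} adj =
  sum (map (λ i → sum (map (λ j →
        if toℕ i <ᵇ toℕ j then dist adj i j else 0)
      (allFinL n))) (allFinL n))

WienerD : ∀ {n} → Rel n → ℕ
WienerD {n} adj =
  sum (map (λ i → sum (map (λ j →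
        if ⌊ i ≟ j ⌋ then 0 else dist adj i j)
      (allFinL n))) (allFinL n))

-- With t = n - 2r + 2 - s, vertex m ∈ {0,…,n-1} is:
--   m < s              : in the first clique (replacing a = c_0, resp. v_1)
--   s ≤ m < s + t      : in the second clique (replacing b = c_1, resp. w_1)
--   m = s + t + k      : the remaining vertex number k ∈ {0,…,2r-3}

cliqueSize₂ : ℕ → ℕ → ℕ → ℕ
cliqueSize₂ n r s = (n + 2) ∸ (2 * r) ∸ s

-- Graph G_{n,r,s}: cycle C_{2r} = c_0 c_1 … c_{2r-1} c_0,
-- a = c_0 replaced by K_s, b = c_1 replaced by K_t.
data GRole : Set where
  inA : GRole
  inB : GRole
  cyc : ℕ → GRole      -- cycle vertex c_i, 2 ≤ i ≤ 2r-1

gRole : ℕ → ℕ → ℕ → ℕ → GRole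
gRole n r s m =
  if m <ᵇ s then inA
  else if m <ᵇ s + cliqueSize₂ n r s then inB
  else cyc (m ∸ (s + cliqueSize₂ n r s) + 2)

gAdjRole : ℕ → GRole → GRole → Bool
gAdjRole r inA     inA     = true
gAdjRole r inB     inB     = true
gAdjRole r inA     inB     = true
gAdjRole r inB     inA     = true
gAdjRole r inA     (cyc j) = j ≡ᵇ (2 * r ∸ 1)
gAdjRole r (cyc i) inA     = i ≡ᵇ (2 * r ∸ 1)
gAdjRole r inB     (cyc j) = j ≡ᵇ 2
gAdjRole r (cyc i) inB     = i ≡ᵇ 2
gAdjRole r (cyc i) (cyc j) = (j ≡ᵇ suc i) ∨ (i ≡ᵇ suc j)

G : (n r s : ℕ) → Rel n
G n r s u v =
  not ⌊ u ≟ v ⌋ ∧ gAdjRole r (gRole n r s (toℕ u)) (gRole n r s (toℕ v))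

-- Digraph D_{n,r,s}: from D_{2r,r,1} on v_1..v_r, w_1..w_r,
-- v_1 replaced by a bidirected clique of size s, w_1 by one of size t.
-- Role (false , i) is v_i, role (true , i) is w_i.
record DRole : Set where
  constructor role
  field
    side : Bool
    idx  : ℕ

dRole : ℕ → ℕ → ℕ → ℕ → DRole
dRole n r s m =
  if m <ᵇ s then role false 1
  else if m <ᵇ s + cliqueSize₂ n r s then role true 1
  else (let k = m ∸ (s + cliqueSize₂ n r s) in
        if k <ᵇ (r ∸ 1) then role false (k + 2)
        else role true (k ∸ (r ∸ 1) + 2))

dArcRole : DRole → DRole → Bool
dArcRole (role false i) (role false j) = j ≤ᵇ suc i
dArcRole (role true  i) (role true  j) = j ≤ᵇ suc i
dArcRole (role false i) (role true  j) = j ≡ᵇ 1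
dArcRole (role true  i) (role false j) = j ≡ᵇ 1

D : (n r s : ℕ) → Rel n
D n r s u v =
  not ⌊ u ≟ v ⌋ ∧ dArcRole (dRole n r s (toℕ u)) (dRole n r s (toℕ v))

-- Both G_{n,r,s} and D_{n,r,s} are blow-ups of a small base graph, the cycle C_{2r} resp. the
-- digraph D_{2r,r,1}: vertex m sits at a base vertex pos m, and the two enlarged base vertices
-- become cliques.  Distances in a blow-up are base distances between positions, except that
-- twins are at distance 1.  This is checked locally, since the shortest-path distance is the
-- only function that vanishes exactly on the diagonal, grows by at most one along an arc, and
-- always decreases by one along some arc into its target.  The Wiener index thereby becomes a
-- weighted double sum over base vertices.  In C_{2r} every row of distances sums to r²; in
-- D_{2r,r,1} every vertex is at distance 1 from v₁ and from w₁, the rows of v₁ and w₁ sum to r²,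
-- and the total is 2 ∑ sideDist + r²(r+1) with 6 ∑ sideDist = r³ + 3r² − 4r.  What remains is
-- polynomial arithmetic.

module Submission where

open import Data.Bool using (Bool; true; false; T; not; _∧_; if_then_else_)
open import Data.Bool.Properties using (T-≡; T-∧; T-∨) renaming (_≟_ to _≟ᴮ_)
open import Data.Empty using (⊥-elim)
open import Data.Fin as Fin using (Fin; toℕ; fromℕ<)
open import Data.Fin.Properties using (toℕ-injective; toℕ<n; toℕ-fromℕ<) renaming (_≟_ to _≟ᶠ_)
open import Data.List using (map; tabulate) renaming (allFin to allFinL)
open import Data.List.Properties using (map-tabulate)
open import Data.List.Membership.Propositional.Properties using (∈-allFin)
open import Data.List.Relation.Unary.Any as Any using (satisfied)
open import Data.List.Relation.Unary.Any.Properties using (any⁺; any⁻)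
open import Data.Nat hiding (_≤ᵇ_)
open import Data.Nat.Combinatorics using (_C_; nC1≡n; nCk+nC[k+1]≡[n+1]C[k+1])
open import Data.Nat.ListAction using (sum)
open import Data.Nat.Properties
open import Algebra.Properties.CommutativeSemigroup +-commutativeSemigroup
  using () renaming (interchange to +-interchange)
open import Data.Nat.Tactic.RingSolver using (solve-∀)
open import Data.Product using (_×_; _,_; proj₁; proj₂; ∃-syntax)
open import Data.Sum using (_⊎_; inj₁; inj₂; swap)
open import Data.Unit using (tt)
open import Function using (_∘_; id; _⇔_; mk⇔; case_of_)
open import Function.Bundles using (module Equivalence)
open import Relation.Binary.Definitions using (DecidableEquality; tri<; tri≈; tri>)
open import Relation.Binary.PropositionalEquality
open import Relation.Nullary using (Dec; yes; no)
open import Relation.Nullary.Decidable using (⌊_⌋; toWitness; fromWitness; map′; _×-dec_; isYes≗does; does-⇔)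
open import Relation.Unary using (U)

open import Defs

∑ : ℕ → (ℕ → ℕ) → ℕ
∑ zero    f = 0
∑ (suc a) f = f 0 + ∑ a (f ∘ suc)

∑-cong : ∀ a {f g : ℕ → ℕ} → (∀ k → k < a → f k ≡ g k) → ∑ a f ≡ ∑ a g
∑-cong zero    e = refl
∑-cong (suc a) e = cong₂ _+_ (e 0 z<s) (∑-cong a (λ k k<a → e (suc k) (s<s k<a)))

∑-distrib-+ : ∀ a (f g : ℕ → ℕ) → ∑ a (λ k → f k + g k) ≡ ∑ a f + ∑ a g
∑-distrib-+ zero    f g = refl
∑-distrib-+ (suc a) f g rewrite ∑-distrib-+ a (f ∘ suc) (g ∘ suc) =
  +-interchange (f 0) (g 0) (∑ a (f ∘ suc)) (∑ a (g ∘ suc))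

∑-split : ∀ a b (f : ℕ → ℕ) → ∑ (a + b) f ≡ ∑ a f + ∑ b (λ k → f (a + k))
∑-split zero    b f = refl
∑-split (suc a) b f rewrite ∑-split a b (f ∘ suc) = sym (+-assoc (f 0) _ _)

∑-const : ∀ a c → ∑ a (λ _ → c) ≡ a * c
∑-const zero    c = refl
∑-const (suc a) c = cong (c +_) (∑-const a c)

∑-zero : ∀ a {f : ℕ → ℕ} → (∀ k → k < a → f k ≡ 0) → ∑ a f ≡ 0
∑-zero a e = trans (∑-cong a e) (trans (∑-const a 0) (*-zeroʳ a))

∑-distribˡ-* : ∀ a c (f : ℕ → ℕ) → ∑ a (λ k → c * f k) ≡ c * ∑ a f
∑-distribˡ-* zero    c f = sym (*-zeroʳ c)
∑-distribˡ-* (suc a) c f rewrite ∑-distribˡ-* a c (f ∘ suc) = sym (*-distribˡ-+ c (f 0) _)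

∑-comm : ∀ a b (F : ℕ → ℕ → ℕ) → ∑ a (λ i → ∑ b (F i)) ≡ ∑ b (λ j → ∑ a (λ i → F i j))
∑-comm zero    b F = sym (∑-zero b (λ _ _ → refl))
∑-comm (suc a) b F rewrite ∑-comm a b (F ∘ suc) = sym (∑-distrib-+ b (F 0) _)

∑-suc : ∀ a (f : ℕ → ℕ) → ∑ (suc a) f ≡ ∑ a f + f a
∑-suc zero    f = +-comm (f 0) 0
∑-suc (suc a) f rewrite ∑-suc a (f ∘ suc) = sym (+-assoc (f 0) _ _)

∑-reverse : ∀ a (f : ℕ → ℕ) → ∑ a f ≡ ∑ a (λ k → f (a ∸ suc k))
∑-reverse zero    f = refl
∑-reverse (suc a) f = begin
  f 0 + ∑ a (f ∘ suc)                      ≡⟨ cong (f 0 +_) (∑-reverse a (f ∘ suc)) ⟩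
  f 0 + ∑ a (λ k → f (suc (a ∸ suc k)))     ≡⟨ +-comm (f 0) _ ⟩
  ∑ a (λ k → f (suc (a ∸ suc k))) + f 0     ≡⟨ cong₂ _+_ (∑-cong a (λ k k<a → cong f (sym (+-∸-assoc 1 k<a))))
                                                         (cong f (sym (n∸n≡0 a))) ⟩
  ∑ a (λ k → f (a ∸ k)) + f (a ∸ a)         ≡⟨ sym (∑-suc a (λ k → f (a ∸ k))) ⟩
  ∑ (suc a) (λ k → f (suc a ∸ suc k))       ∎
  where open ≡-Reasoning

∑-id-double : ∀ a → ∑ a id + ∑ a id + a ≡ a * a
∑-id-double zero    = refl
∑-id-double (suc a) = begin
  ∑ (suc a) id + ∑ (suc a) id + suc a ≡⟨ cong (λ x → x + x + suc a) (∑-suc a id) ⟩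
  (∑ a id + a) + (∑ a id + a) + suc a ≡⟨ regroup (∑ a id) a ⟩
  (∑ a id + ∑ a id + a) + (a + a + 1) ≡⟨ cong (_+ (a + a + 1)) (∑-id-double a) ⟩
  a * a + (a + a + 1)                 ≡⟨ square-suc a ⟩
  suc a * suc a                       ∎
  where
  open ≡-Reasoning
  regroup : ∀ x a → (x + a) + (x + a) + suc a ≡ (x + x + a) + (a + a + 1)
  regroup = solve-∀
  square-suc : ∀ a → a * a + (a + a + 1) ≡ suc a * suc a
  square-suc = solve-∀

∑-suc-id : ∀ a → ∑ a suc ≡ ∑ a id + a
∑-suc-id a = trans (∑-cong a (λ k _ → +-comm 1 k)) (trans (∑-distrib-+ a id (λ _ → 1))
                   (cong (∑ a id +_) (trans (∑-const a 1) (*-identityʳ a))))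

∑-suc-double : ∀ a → ∑ a suc + ∑ a suc ≡ a * a + a
∑-suc-double a = begin
  ∑ a suc + ∑ a suc                ≡⟨ cong (λ x → x + x) (∑-suc-id a) ⟩
  (∑ a id + a) + (∑ a id + a)      ≡⟨ regroup (∑ a id) a ⟩
  (∑ a id + ∑ a id + a) + a        ≡⟨ cong (_+ a) (∑-id-double a) ⟩
  a * a + a                        ∎
  where
  open ≡-Reasoning
  regroup : ∀ x a → (x + a) + (x + a) ≡ (x + x + a) + a
  regroup = solve-∀

∑-countdown : ∀ a → ∑ a (a ∸_) ≡ ∑ a suc
∑-countdown a = trans (∑-reverse a (a ∸_)) (∑-cong a (λ k k<a → m∸[m∸n]≡n k<a))

indicator : Bool → ℕ
indicator true  = 1
indicator false = 0

⌊⌋-⇔ : ∀ {A B : Set} → A ⇔ B → (a? : Dec A) (b? : Dec B) → ⌊ a? ⌋ ≡ ⌊ b? ⌋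
⌊⌋-⇔ A⇔B a? b? = trans (isYes≗does a?) (trans (does-⇔ A⇔B a? b?) (sym (isYes≗does b?)))

≟-suc : ∀ x k → ⌊ suc x ≟ suc k ⌋ ≡ ⌊ x ≟ k ⌋
≟-suc x k = ⌊⌋-⇔ (mk⇔ suc-injective (cong suc)) (suc x ≟ suc k) (x ≟ k)

≟-sym : ∀ x y → ⌊ x ≟ y ⌋ ≡ ⌊ y ≟ x ⌋
≟-sym x y = ⌊⌋-⇔ (mk⇔ sym sym) (x ≟ y) (y ≟ x)

∑-indicator-≟ : ∀ c x → x < c → ∑ c (λ k → indicator ⌊ x ≟ k ⌋) ≡ 1
∑-indicator-≟ (suc c) zero    _          = cong suc (∑-zero c (λ _ _ → refl))
∑-indicator-≟ (suc c) (suc x) (s≤s x<c) =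
  trans (∑-cong c (λ k _ → cong indicator (≟-suc x k))) (∑-indicator-≟ c x x<c)

∑-diagonal : ∀ n → ∑ n (λ a → ∑ n (λ b → indicator ⌊ a ≟ b ⌋)) ≡ n
∑-diagonal n = trans (∑-cong n (λ a a<n → ∑-indicator-≟ n a a<n)) (trans (∑-const n 1) (*-identityʳ n))

sum-tabulate : ∀ n (g : Fin n → ℕ) (h : ℕ → ℕ) → (∀ i → g i ≡ h (toℕ i)) → sum (tabulate g) ≡ ∑ n h
sum-tabulate zero    g h e = refl
sum-tabulate (suc n) g h e = cong₂ _+_ (e Fin.zero) (sum-tabulate n (g ∘ Fin.suc) (h ∘ suc) (e ∘ Fin.suc))

sum-allFin : ∀ n (g : Fin n → ℕ) (h : ℕ → ℕ) → (∀ i → g i ≡ h (toℕ i)) → sum (map g (allFinL n)) ≡ ∑ n h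
sum-allFin n g h e = trans (cong sum (map-tabulate id g)) (sum-tabulate n g h e)

<ᵇ-true : ∀ {a b} → a < b → (a <ᵇ b) ≡ true
<ᵇ-true a<b = Equivalence.to T-≡ (<⇒<ᵇ a<b)

<ᵇ-false : ∀ {a b} → b ≤ a → (a <ᵇ b) ≡ false
<ᵇ-false {a} {b} b≤a with a <ᵇ b in eq
... | true  = ⊥-elim (<⇒≱ (<ᵇ⇒< a b (Equivalence.from T-≡ eq)) b≤a)
... | false = refl

strictUpper : (ℕ → ℕ → ℕ) → ℕ → ℕ → ℕ
strictUpper F a b = if a <ᵇ b then F a b else 0

∑-strictUpper-double : ∀ n (F : ℕ → ℕ → ℕ) → (∀ a b → F a b ≡ F b a) → (∀ a → F a a ≡ 0) →
  let Upper = ∑ n (λ a → ∑ n (strictUpper F a)) in Upper + Upper ≡ ∑ n (λ a → ∑ n (F a))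
∑-strictUpper-double n F F-sym F-diag = sym (begin
  ∑ n (λ a → ∑ n (F a))                                         ≡⟨ ∑-cong n (λ a _ → ∑-cong n (λ b _ → split a b)) ⟩
  ∑ n (λ a → ∑ n (λ b → strictUpper F a b + strictUpper F b a))  ≡⟨ ∑-cong n (λ a _ → ∑-distrib-+ n _ _) ⟩
  ∑ n (λ a → ∑ n (strictUpper F a) + ∑ n (λ b → strictUpper F b a)) ≡⟨ ∑-distrib-+ n _ _ ⟩
  Upper + ∑ n (λ a → ∑ n (λ b → strictUpper F b a))                  ≡⟨ cong (Upper +_) (∑-comm n n (λ a b → strictUpper F b a)) ⟩
  Upper + Upper                                                          ∎)
  where
  open ≡-Reasoning
  Upper = ∑ n (λ a → ∑ n (strictUpper F a))
  split : ∀ a b → F a b ≡ strictUpper F a b + strictUpper F b a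
  split a b with <-cmp a b
  ... | tri< a<b _ _ rewrite <ᵇ-true a<b | <ᵇ-false (<⇒≤ a<b) = sym (+-identityʳ _)
  ... | tri≈ _ refl _ rewrite <ᵇ-false (≤-refl {a}) = F-diag a
  ... | tri> _ _ b<a rewrite <ᵇ-true b<a | <ᵇ-false (<⇒≤ b<a) = F-sym a b

record IsPathMetric {X : Set} (V : X → Set) (A : X → X → Bool) (d : X → X → ℕ) : Set where
  field
    d-refl : ∀ x → d x x ≡ 0
    d-zero : ∀ {x y} → V x → V y → d x y ≡ 0 → x ≡ y
    d-arc  : ∀ {x y z} → V x → V y → V z → T (A y z) → d x z ≤ suc (d x y)
    d-pred : ∀ {x z k} → V x → V z → d x z ≡ suc k → ∃[ y ] V y × d x y ≡ k × T (A y z)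

module ShortestPath {n} (adj : Rel n) (δ : Fin n → Fin n → ℕ)
                    (δ-metric : IsPathMetric U adj δ) (δ-bounded : ∀ u v → δ u v ≤ n) where
  open IsPathMetric δ-metric

  reach⇒≤ : ∀ k u v → T (reach adj k u v) → δ u v ≤ k
  reach⇒≤ zero    u v u≡v = ≤-reflexive (trans (cong (δ u) (sym (toWitness u≡v))) (d-refl u))
  reach⇒≤ (suc k) u v r with Equivalence.to T-∨ r
  ... | inj₁ r′ = m≤n⇒m≤1+n (reach⇒≤ k u v r′)
  ... | inj₂ r′ with satisfied (any⁻ _ (allFinL n) r′)
  ...   | w , rw = ≤-trans (d-arc tt tt tt (proj₂ rw∧)) (s≤s (reach⇒≤ k u w (proj₁ rw∧)))
    where rw∧ = Equivalence.to T-∧ rw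

  ≤⇒reach : ∀ k u v → δ u v ≤ k → T (reach adj k u v)
  ≤⇒reach zero    u v δ≤0 = fromWitness (d-zero tt tt (n≤0⇒n≡0 δ≤0))
  ≤⇒reach (suc k) u v δ≤ with m≤n⇒m<n∨m≡n δ≤
  ... | inj₁ δ<  = Equivalence.from T-∨ (inj₁ (≤⇒reach k u v (≤-pred δ<)))
  ... | inj₂ δ≡ with d-pred tt tt δ≡
  ...   | w , _ , δw , arc = Equivalence.from T-∨ (inj₂ (any⁺ _ (Any.map (λ { refl → step }) (∈-allFin w))))
    where step = Equivalence.from T-∧ (≤⇒reach k u w (≤-reflexive δw) , arc)

  distSearch-correct : ∀ fuel k u v → k ≤ δ u v → δ u v < k + fuel → distSearch adj u v k fuel ≡ δ u v
  distSearch-correct zero       k u v k≤δ δ< = ⊥-elim (<⇒≱ (subst (δ u v <_) (+-identityʳ k) δ<) k≤δ)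
  distSearch-correct (suc fuel) k u v k≤δ δ< with reach adj k u v in eq
  ... | true  = ≤-antisym k≤δ (reach⇒≤ k u v (Equivalence.from T-≡ eq))
  ... | false = distSearch-correct fuel (suc k) u v
                  (≰⇒> (λ δ≤k → subst T eq (≤⇒reach k u v δ≤k))) (subst (δ u v <_) (+-suc k fuel) δ<)

  dist-unique : ∀ u v → dist adj u v ≡ δ u v
  dist-unique u v = distSearch-correct (suc n) 0 u v z≤n (s≤s (δ-bounded u v))

module Blowup {P : Set} (_≟ᴾ_ : DecidableEquality P) (A : P → P → Bool) (d : P → P → ℕ)
  (V : P → Set) (d-metric : IsPathMetric V A d)
  (n : ℕ) (pos : ℕ → P) (pos-valid : ∀ {m} → m < n → V (pos m))
  (pos-onto : ∀ {x} → V x → ∃[ m ] m < n × pos m ≡ x)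
  (clique : ∀ {m m′} → m < n → m′ < n → m ≢ m′ → pos m ≡ pos m′ → T (A (pos m) (pos m)))
  (d-bounded : ∀ {x y} → V x → V y → d x y ≤ n)
  (adj : Rel n) (adj-blowup : ∀ u v → adj u v ≡ (not ⌊ u ≟ᶠ v ⌋ ∧ A (pos (toℕ u)) (pos (toℕ v))))
  where
  open IsPathMetric d-metric

  δ : ℕ → ℕ → ℕ
  δ a b = if ⌊ a ≟ b ⌋ then 0 else if ⌊ pos a ≟ᴾ pos b ⌋ then 1 else d (pos a) (pos b)

  δ-refl : ∀ a → δ a a ≡ 0
  δ-refl a with a ≟ a
  ... | yes _  = refl
  ... | no a≢a = ⊥-elim (a≢a refl)

  δ-apart : ∀ {a b} → pos a ≢ pos b → δ a b ≡ d (pos a) (pos b)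
  δ-apart {a} {b} pa≢pb with a ≟ b | pos a ≟ᴾ pos b
  ... | yes refl | _        = ⊥-elim (pa≢pb refl)
  ... | no _     | yes pa≡pb = ⊥-elim (pa≢pb pa≡pb)
  ... | no _     | no _      = refl

  d≤δ : ∀ a b → d (pos a) (pos b) ≤ δ a b
  d≤δ a b with a ≟ b | pos a ≟ᴾ pos b
  ... | yes refl | _        = ≤-reflexive (d-refl (pos a))
  ... | no _     | yes pa≡pb = ≤-trans (≤-reflexive (trans (cong (d (pos a)) (sym pa≡pb)) (d-refl (pos a)))) z≤n
  ... | no _     | no _      = ≤-refl

  δF : Fin n → Fin n → ℕ
  δF u v = δ (toℕ u) (toℕ v)

  posᶠ : Fin n → P
  posᶠ u = pos (toℕ u)

  arc-intro : ∀ {u v} → toℕ u ≢ toℕ v → T (A (posᶠ u) (posᶠ v)) → T (adj u v)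
  arc-intro {u} {v} u≢v a = subst T (sym (adj-blowup u v)) (Equivalence.from T-∧ (distinct , a))
    where
    distinct : T (not ⌊ u ≟ᶠ v ⌋)
    distinct with u ≟ᶠ v
    ... | yes refl = ⊥-elim (u≢v refl)
    ... | no _     = tt

  arc-elim : ∀ {u v} → T (adj u v) → T (A (posᶠ u) (posᶠ v))
  arc-elim {u} {v} a rewrite adj-blowup u v = proj₂ (Equivalence.to T-∧ a)

  δ-zero : ∀ {a b} → a < n → b < n → δ a b ≡ 0 → a ≡ b
  δ-zero {a} {b} a<n b<n eq with a ≟ b | pos a ≟ᴾ pos b
  ... | yes a≡b | _        = a≡b
  ... | no _    | yes _    = case eq of λ ()
  ... | no _    | no pa≢pb = ⊥-elim (pa≢pb (d-zero (pos-valid a<n) (pos-valid b<n) eq))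

  δ-arc : ∀ {a b c} → a < n → b < n → c < n → T (A (pos b) (pos c)) → δ a c ≤ suc (δ a b)
  δ-arc {a} {b} {c} a<n b<n c<n arc with a ≟ c | pos a ≟ᴾ pos c
  ... | yes _ | _     = z≤n
  ... | no _  | yes _ = s≤s z≤n
  ... | no _  | no _  = ≤-trans (d-arc (pos-valid a<n) (pos-valid b<n) (pos-valid c<n) arc) (s≤s (d≤δ a b))

  δ-pred : ∀ {a c k} → a < n → c < n → δ a c ≡ suc k →
           ∃[ b ] b < n × δ a b ≡ k × b ≢ c × T (A (pos b) (pos c))
  δ-pred {a} {c} {k} a<n c<n eq with a ≟ c | pos a ≟ᴾ pos c
  ... | yes _   | _         = case eq of λ ()
  ... | no a≢c  | yes pa≡pc =
    a , a<n , trans (δ-refl a) (suc-injective eq) , a≢c ,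
    subst (λ x → T (A (pos a) x)) pa≡pc (clique a<n c<n a≢c pa≡pc)
  ... | no a≢c  | no pa≢pc with d-pred (pos-valid a<n) (pos-valid c<n) eq
  ...   | y , valid-y , dy , arc with k
  ...     | zero =
    a , a<n , δ-refl a , a≢c , subst (λ x → T (A x (pos c))) (sym (d-zero (pos-valid a<n) valid-y dy)) arc
  ...     | suc k′ with pos-onto valid-y
  ...       | b , b<n , refl = b , b<n , trans (δ-apart pa≢pb) dy , b≢c , arc
    where
    pa≢pb : pos a ≢ pos b
    pa≢pb e = case trans (sym (d-refl (pos a))) (trans (cong (d (pos a)) e) dy) of λ ()
    b≢c : b ≢ c
    b≢c refl = 1+n≢n (suc-injective (trans (sym eq) dy))

  δ-bounded : ∀ {a b} → a < n → b < n → δ a b ≤ n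
  δ-bounded {a} {b} a<n b<n with a ≟ b | pos a ≟ᴾ pos b
  ... | yes _ | _     = z≤n
  ... | no _  | yes _ = ≤-trans (s≤s z≤n) a<n
  ... | no _  | no _  = d-bounded (pos-valid a<n) (pos-valid b<n)

  δF-pred : ∀ {u v k} → δF u v ≡ suc k → ∃[ w ] U w × δF u w ≡ k × T (adj w v)
  δF-pred {u} {v} eq with δ-pred (toℕ<n u) (toℕ<n v) eq
  ... | b , b<n , δab , b≢v , arc =
    fromℕ< b<n , tt , subst (λ x → δ (toℕ u) x ≡ _) (sym (toℕ-fromℕ< b<n)) δab ,
    arc-intro (subst (_≢ toℕ v) (sym (toℕ-fromℕ< b<n)) b≢v)
              (subst (λ x → T (A (pos x) (posᶠ v))) (sym (toℕ-fromℕ< b<n)) arc)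

  δF-metric : IsPathMetric U adj δF
  δF-metric = record
    { d-refl = λ u → δ-refl (toℕ u)
    ; d-zero = λ {u} {v} _ _ eq → toℕ-injective (δ-zero (toℕ<n u) (toℕ<n v) eq)
    ; d-arc  = λ {u} {w} {v} _ _ _ a → δ-arc (toℕ<n u) (toℕ<n w) (toℕ<n v) (arc-elim a)
    ; d-pred = λ {u} _ _ → δF-pred {u}
    }

  dist-blowup : ∀ u v → dist adj u v ≡ δF u v
  dist-blowup = ShortestPath.dist-unique adj δF δF-metric (λ u v → δ-bounded (toℕ<n u) (toℕ<n v))

  -- Twins (distinct vertices with the same position) are at distance 1 but have d = 0;
  -- adding the diagonal indicator on both sides makes the two sums agree termwise.
  d⁺ : P → P → ℕ
  d⁺ x y = d x y + indicator ⌊ x ≟ᴾ y ⌋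

  δ+diagonal : ∀ a b → δ a b + indicator ⌊ a ≟ b ⌋ ≡ d⁺ (pos a) (pos b)
  δ+diagonal a b with a ≟ b | pos a ≟ᴾ pos b
  ... | yes refl | yes _     = cong (_+ 1) (sym (d-refl (pos a)))
  ... | yes refl | no pa≢pa  = ⊥-elim (pa≢pa refl)
  ... | no _     | yes pa≡pb = cong (_+ 1) (sym (trans (cong (d (pos a)) (sym pa≡pb)) (d-refl (pos a))))
  ... | no _     | no _      = refl

  ∑∑δ+n : ∑ n (λ a → ∑ n (δ a)) + n ≡ ∑ n (λ a → ∑ n (λ b → d⁺ (pos a) (pos b)))
  ∑∑δ+n = begin
    ∑ n (λ a → ∑ n (δ a)) + n
      ≡⟨ cong (∑ n (λ a → ∑ n (δ a)) +_) (sym (∑-diagonal n)) ⟩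
    ∑ n (λ a → ∑ n (δ a)) + ∑ n (λ a → ∑ n (λ b → indicator ⌊ a ≟ b ⌋))
      ≡⟨ sym (∑-distrib-+ n _ _) ⟩
    ∑ n (λ a → ∑ n (δ a) + ∑ n (λ b → indicator ⌊ a ≟ b ⌋))
      ≡⟨ ∑-cong n (λ a _ → trans (sym (∑-distrib-+ n _ _)) (∑-cong n (λ b _ → δ+diagonal a b))) ⟩
    ∑ n (λ a → ∑ n (λ b → d⁺ (pos a) (pos b))) ∎
    where open ≡-Reasoning

  WienerD-blowup : WienerD adj + n ≡ ∑ n (λ a → ∑ n (λ b → d⁺ (pos a) (pos b)))
  WienerD-blowup = trans (cong (_+ n) WienerD≡) ∑∑δ+n
    where
    if-then-0 : ∀ b {x} → (T b → x ≡ 0) → (if b then 0 else x) ≡ x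
    if-then-0 true  x≡0 = sym (x≡0 tt)
    if-then-0 false _   = refl
    term : ∀ u v → (if ⌊ u ≟ᶠ v ⌋ then 0 else dist adj u v) ≡ δF u v
    term u v = trans (if-then-0 ⌊ u ≟ᶠ v ⌋ (λ u≡v → trans (dist-blowup u v)
                 (subst (λ w → δF u w ≡ 0) (toWitness u≡v) (δ-refl (toℕ u))))) (dist-blowup u v)
    WienerD≡ : WienerD adj ≡ ∑ n (λ a → ∑ n (δ a))
    WienerD≡ = sum-allFin n _ _ (λ u → sum-allFin n _ _ (term u))

  WienerG-blowup : (∀ x y → d x y ≡ d y x) →
                   WienerG adj + WienerG adj + n ≡ ∑ n (λ a → ∑ n (λ b → d⁺ (pos a) (pos b)))
  WienerG-blowup d-sym = trans (cong (_+ n) (trans (cong₂ _+_ WienerG≡ WienerG≡)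
                                  (∑-strictUpper-double n δ δ-sym δ-refl))) ∑∑δ+n
    where
    WienerG≡ : WienerG adj ≡ ∑ n (λ a → ∑ n (strictUpper δ a))
    WienerG≡ = sum-allFin n _ _ (λ u → sum-allFin n _ _ (λ v →
                 cong (if toℕ u <ᵇ toℕ v then_else 0) (dist-blowup u v)))
    δ-sym : ∀ a b → δ a b ≡ δ b a
    δ-sym a b with a ≟ b | b ≟ a | pos a ≟ᴾ pos b | pos b ≟ᴾ pos a
    ... | yes _ | yes _ | _ | _ = refl
    ... | yes a≡b | no b≢a | _ | _ = ⊥-elim (b≢a (sym a≡b))
    ... | no a≢b | yes b≡a | _ | _ = ⊥-elim (a≢b (sym b≡a))
    ... | no _ | no _ | yes _ | yes _ = refl
    ... | no _ | no _ | yes e | no ne = ⊥-elim (ne (sym e))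
    ... | no _ | no _ | no ne | yes e = ⊥-elim (ne (sym e))
    ... | no _ | no _ | no _ | no _ = d-sym (pos a) (pos b)

module Layout {P : Set} (pos : ℕ → P) (x₀ x₁ : P) (ρ : ℕ → P) (s′ t′ c n : ℕ)
  (size : suc s′ + suc t′ + c ≡ n)
  (pos₀ : ∀ {m} → m < suc s′ → pos m ≡ x₀)
  (pos₁ : ∀ {k} → k < suc t′ → pos (suc s′ + k) ≡ x₁)
  (posρ : ∀ {k} → k < c → pos (suc s′ + suc t′ + k) ≡ ρ k) where

  private
    s = suc s′
    t = suc t′

  ∑-layout : ∀ (F : P → ℕ) → ∑ n (F ∘ pos) ≡ s′ * F x₀ + t′ * F x₁ + (F x₀ + (F x₁ + ∑ c (F ∘ ρ)))
  ∑-layout F = begin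
    ∑ n (F ∘ pos)
      ≡⟨ cong (λ m → ∑ m (F ∘ pos)) (sym size) ⟩
    ∑ (s + t + c) (F ∘ pos)
      ≡⟨ ∑-split (s + t) c (F ∘ pos) ⟩
    ∑ (s + t) (F ∘ pos) + ∑ c (λ k → F (pos (s + t + k)))
      ≡⟨ cong (_+ ∑ c (λ k → F (pos (s + t + k)))) (∑-split s t (F ∘ pos)) ⟩
    ∑ s (F ∘ pos) + ∑ t (λ k → F (pos (s + k))) + ∑ c (λ k → F (pos (s + t + k)))
      ≡⟨ cong₂ _+_ (cong₂ _+_ (trans (∑-cong s (λ _ m<s → cong F (pos₀ m<s))) (∑-const s (F x₀)))
                               (trans (∑-cong t (λ _ k<t → cong F (pos₁ k<t))) (∑-const t (F x₁))))
                   (∑-cong c (λ _ k<c → cong F (posρ k<c))) ⟩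
    s * F x₀ + t * F x₁ + ∑ c (F ∘ ρ)
      ≡⟨ excess s′ t′ (F x₀) (F x₁) (∑ c (F ∘ ρ)) ⟩
    s′ * F x₀ + t′ * F x₁ + (F x₀ + (F x₁ + ∑ c (F ∘ ρ))) ∎
    where
    open ≡-Reasoning
    excess : ∀ s′ t′ x y z → suc s′ * x + suc t′ * y + z ≡ s′ * x + t′ * y + (x + (y + z))
    excess = solve-∀

  layout-valid : ∀ (V : P → Set) → V x₀ → V x₁ → (∀ {k} → k < c → V (ρ k)) → ∀ {m} → m < n → V (pos m)
  layout-valid V V₀ V₁ Vρ {m} m<n with m <? s | m <? s + t
  ... | yes m<s | _        = subst V (sym (pos₀ m<s)) V₀
  ... | no m≮s  | yes m<st = subst V (sym (trans (cong pos (sym (m+[n∸m]≡n s≤m))) (pos₁ k<t))) V₁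
    where
    s≤m = ≮⇒≥ m≮s
    k<t = +-cancelˡ-< s (m ∸ s) t (subst (_< s + t) (sym (m+[n∸m]≡n s≤m)) m<st)
  ... | no _    | no m≮st  = subst V (sym (trans (cong pos (sym (m+[n∸m]≡n st≤m))) (posρ k<c))) (Vρ k<c)
    where
    st≤m = ≮⇒≥ m≮st
    k<c = +-cancelˡ-< (s + t) (m ∸ (s + t)) c (subst (_< s + t + c) (sym (m+[n∸m]≡n st≤m)) (subst (m <_) (sym size) m<n))

  layout-onto : ∀ {x} → x ≡ x₀ ⊎ x ≡ x₁ ⊎ (∃[ k ] k < c × ρ k ≡ x) → ∃[ m ] m < n × pos m ≡ x
  layout-onto (inj₁ refl) = 0 , subst (0 <_) size z<s , pos₀ z<s
  layout-onto (inj₂ (inj₁ refl)) =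
    s + 0 , subst (s + 0 <_) (trans (sym (+-assoc s t c)) size) (+-monoʳ-< s z<s) , pos₁ z<s
  layout-onto (inj₂ (inj₂ (k , k<c , refl))) =
    s + t + k , subst (s + t + k <_) size (+-monoʳ-< (s + t) k<c) , posρ k<c

data CycleStep (N a b : ℕ) : Set where
  step-up   : b ≡ suc a → CycleStep N a b
  step-down : a ≡ suc b → CycleStep N a b
  wrap-down : a ≡ 0 → suc b ≡ N → CycleStep N a b
  wrap-up   : suc a ≡ N → b ≡ 0 → CycleStep N a b
  stay      : a ≡ b → CycleStep N a b

∣-∣-suc : ∀ a b → ∣ a - suc b ∣ ≡ suc ∣ a - b ∣ ⊎ ∣ a - b ∣ ≡ suc ∣ a - suc b ∣
∣-∣-suc zero    b       = inj₁ refl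
∣-∣-suc (suc a) zero    = inj₂ (cong suc (sym (∣-∣-identityʳ a)))
∣-∣-suc (suc a) (suc b) = ∣-∣-suc a b

∣-∣-< : ∀ {a b N} → a < N → b < N → ∣ a - b ∣ < N
∣-∣-< {a} {b} a<N b<N = ≤-<-trans (∣m-n∣≤m⊔n a b) (⊔-lub a<N b<N)

module Cycle (r : ℕ) (A : ℕ → ℕ → Bool)
  (A-step : ∀ {a b} → T (A a b) → CycleStep (2 * r) a b)
  (A-up : ∀ a → T (A a (suc a))) (A-down : ∀ a → T (A (suc a) a))
  (A-wrap-down : T (A 0 (2 * r ∸ 1))) (A-wrap-up : T (A (2 * r ∸ 1) 0)) where

  N : ℕ
  N = 2 * r

  N≡r+r : N ≡ r + r
  N≡r+r = cong (r +_) (+-identityʳ r)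

  f : ℕ → ℕ
  f x = x ⊓ (N ∸ x)

  f-low : ∀ {x} → x ≤ r → f x ≡ x
  f-low {x} x≤r = m≤n⇒m⊓n≡m (begin
    x         ≤⟨ x≤r ⟩
    r         ≡⟨ sym (m+n∸n≡m r r) ⟩
    r + r ∸ r ≤⟨ ∸-monoʳ-≤ (r + r) x≤r ⟩
    r + r ∸ x ≡⟨ cong (_∸ x) (sym N≡r+r) ⟩
    N ∸ x     ∎)
    where open ≤-Reasoning

  f-high : ∀ {x} → r ≤ x → f x ≡ N ∸ x
  f-high {x} r≤x = m≥n⇒m⊓n≡n (begin
    N ∸ x     ≡⟨ cong (_∸ x) N≡r+r ⟩
    r + r ∸ x ≤⟨ ∸-monoʳ-≤ (r + r) r≤x ⟩
    r + r ∸ r ≡⟨ m+n∸n≡m r r ⟩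
    r         ≤⟨ r≤x ⟩
    x         ∎)
    where open ≤-Reasoning

  f-reflect : ∀ {x} → x ≤ N → f (N ∸ x) ≡ f x
  f-reflect {x} x≤N = trans (cong ((N ∸ x) ⊓_) (m∸[m∸n]≡n x≤N)) (⊓-comm (N ∸ x) x)

  f-near-step : ∀ {x} → suc x ≤ r → f (suc x) ≡ suc (f x)
  f-near-step sx≤r = trans (f-low sx≤r) (cong suc (sym (f-low (≤-trans (n≤1+n _) sx≤r))))

  f-far-step : ∀ {x} → r ≤ x → suc x ≤ N → f x ≡ suc (f (suc x))
  f-far-step {x} r≤x sx≤N = trans (f-high r≤x) (trans (+-∸-assoc 1 sx≤N) (cong suc (sym (f-high (m≤n⇒m≤1+n r≤x)))))

  f-suc-≤ : ∀ {x} → suc x ≤ N → f (suc x) ≤ suc (f x)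
  f-suc-≤ {x} sx≤N with x <? r
  ... | yes x<r = ≤-reflexive (f-near-step x<r)
  ... | no  x≮r = m≤n⇒m≤1+n (≤-trans (n≤1+n _) (≤-reflexive (sym (f-far-step (≮⇒≥ x≮r) sx≤N))))

  f-≤-suc : ∀ {x} → suc x ≤ N → f x ≤ suc (f (suc x))
  f-≤-suc {x} sx≤N with x <? r
  ... | yes x<r = m≤n⇒m≤1+n (≤-trans (n≤1+n _) (≤-reflexive (sym (f-near-step x<r))))
  ... | no  x≮r = ≤-reflexive (f-far-step (≮⇒≥ x≮r) sx≤N)

  f-zero : ∀ {x} → x < N → f x ≡ 0 → x ≡ 0
  f-zero {x} x<N fx≡0 with x <? r
  ... | yes x<r = trans (sym (f-low (<⇒≤ x<r))) fx≡0
  ... | no  x≮r = case trans (sym (f-far-step (≮⇒≥ x≮r) x<N)) fx≡0 of λ ()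

  cd : ℕ → ℕ → ℕ
  cd a b = f ∣ a - b ∣

  cd-refl : ∀ a → cd a a ≡ 0
  cd-refl a = cong f (∣n-n∣≡0 a)

  cd-sym : ∀ a b → cd a b ≡ cd b a
  cd-sym a b = cong f (∣-∣-comm a b)

  cd-zero : ∀ {a b} → a < N → b < N → cd a b ≡ 0 → a ≡ b
  cd-zero a<N b<N eq = ∣m-n∣≡0⇒m≡n (f-zero (∣-∣-< a<N b<N) eq)

  cd-offset : ∀ a x → cd a (a + x) ≡ f x
  cd-offset a x = cong f (∣m-m+n∣≡n a x)

  cd-offset′ : ∀ c x → cd (c + x) c ≡ f x
  cd-offset′ c x = trans (cd-sym (c + x) c) (cd-offset c x)

  cd-to-last : ∀ {a c} → suc c ≡ N → a < N → cd a c ≡ f (suc a)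
  cd-to-last {a} {c} sc≡N a<N = begin
    f ∣ a - c ∣     ≡⟨ cong f (m≤n⇒∣m-n∣≡n∸m (≤-pred (subst (a <_) (sym sc≡N) a<N))) ⟩
    f (c ∸ a)       ≡⟨ cong (λ m → f (m ∸ suc a)) sc≡N ⟩
    f (N ∸ suc a)   ≡⟨ f-reflect a<N ⟩
    f (suc a)       ∎
    where open ≡-Reasoning

  f-adjacent : ∀ {x y} → x < N → y < N → y ≡ suc x ⊎ x ≡ suc y → f y ≤ suc (f x)
  f-adjacent x<N y<N (inj₁ refl) = f-suc-≤ (<⇒≤ y<N)
  f-adjacent x<N y<N (inj₂ refl) = f-≤-suc (<⇒≤ x<N)

  cd-arc : ∀ {a b c} → a < N → b < N → c < N → CycleStep N b c → cd a c ≤ suc (cd a b)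
  cd-arc {a} {b} a<N b<N c<N (step-up refl) =
    f-adjacent (∣-∣-< a<N b<N) (∣-∣-< a<N c<N) (∣-∣-suc a b)
  cd-arc {a} {b} {c} a<N b<N c<N (step-down refl) =
    f-adjacent (∣-∣-< a<N b<N) (∣-∣-< a<N c<N) (swap (∣-∣-suc a c))
  cd-arc {a} a<N b<N c<N (wrap-down refl sc≡N)
    rewrite cd-to-last sc≡N a<N | ∣-∣-identityʳ a = f-suc-≤ a<N
  cd-arc {a} a<N b<N c<N (wrap-up sb≡N refl)
    rewrite cd-to-last sb≡N a<N | ∣-∣-identityʳ a = f-≤-suc a<N
  cd-arc a<N b<N c<N (stay refl) = n≤1+n _

  pred-below : ∀ {k} a x → a + x < N → f x ≡ suc k → ∃[ b ] b < N × cd a b ≡ k × T (A b (a + x))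
  pred-below a x c<N fx with x ≤? r
  pred-below a zero    c<N () | yes _
  pred-below a (suc y) c<N fx | yes x≤r =
    a + y , <-trans (+-monoʳ-< a (n<1+n y)) c<N ,
    trans (cd-offset a y) (suc-injective (trans (sym (f-near-step x≤r)) fx)) ,
    subst (λ z → T (A (a + y) z)) (sym (+-suc a y)) (A-up (a + y))
  pred-below a x c<N fx | no x≰r with suc (a + x) <? N
  ... | yes sc<N = suc (a + x) , sc<N ,
                   trans (cong (cd a) (sym (+-suc a x))) (trans (cd-offset a (suc x)) k≡) , A-down (a + x)
    where k≡ = suc-injective (trans (sym (f-far-step (<⇒≤ (≰⇒> x≰r)) (≤-trans (s≤s (m≤n+m x a)) c<N))) fx)
  ... | no sc≮N = 0 , ≤-<-trans z≤n c<N ,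
                  trans (cong f (∣-∣-identityʳ a)) (trans (cong f a≡) (trans (f-reflect sx≤N) k≡)) ,
                  subst (λ z → T (A 0 z)) (cong (_∸ 1) (sym sc≡N)) A-wrap-down
    where
    sc≡N : suc (a + x) ≡ N
    sc≡N = ≤-antisym c<N (≮⇒≥ sc≮N)
    sx≤N : suc x ≤ N
    sx≤N = ≤-trans (s≤s (m≤n+m x a)) c<N
    a≡ : a ≡ N ∸ suc x
    a≡ = trans (sym (m+n∸n≡m a (suc x))) (cong (_∸ suc x) (trans (+-suc a x) sc≡N))
    k≡ = suc-injective (trans (sym (f-far-step (<⇒≤ (≰⇒> x≰r)) sx≤N)) fx)

  pred-above : ∀ {k} c x → c + x < N → f x ≡ suc k → ∃[ b ] b < N × cd (c + x) b ≡ k × T (A b c)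
  pred-above c x a<N fx with x ≤? r
  pred-above c zero    a<N () | yes _
  pred-above c (suc y) a<N fx | yes x≤r =
    suc c , ≤-<-trans (subst (suc c ≤_) (sym (+-suc c y)) (s≤s (m≤m+n c y))) a<N ,
    trans (cong (λ z → cd z (suc c)) (+-suc c y))
      (trans (cd-offset′ (suc c) y) (suc-injective (trans (sym (f-near-step x≤r)) fx))) ,
    A-down c
  pred-above (suc c′) x a<N fx | no x≰r =
    c′ , <-trans (n<1+n c′) (≤-<-trans (s≤s (m≤m+n c′ x)) a<N) ,
    trans (cong (λ z → cd z c′) (sym (+-suc c′ x))) (trans (cd-offset′ c′ (suc x)) k≡) , A-up c′
    where k≡ = suc-injective (trans (sym (f-far-step (<⇒≤ (≰⇒> x≰r)) (≤-trans (s≤s (m≤n+m x (suc c′))) a<N))) fx)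
  pred-above zero x a<N fx | no x≰r =
    N ∸ 1 , subst (N ∸ 1 <_) sN∸1≡N ≤-refl , trans (cd-to-last sN∸1≡N a<N) k≡ , A-wrap-up
    where
    sN∸1≡N : suc (N ∸ 1) ≡ N
    sN∸1≡N = m+[n∸m]≡n {1} (≤-<-trans z≤n a<N)
    k≡ = suc-injective (trans (sym (f-far-step (<⇒≤ (≰⇒> x≰r)) a<N)) fx)

  cd-pred : ∀ {a c k} → a < N → c < N → cd a c ≡ suc k → ∃[ b ] b < N × cd a b ≡ k × T (A b c)
  cd-pred {a} {c} a<N c<N eq with ≤-total a c
  ... | inj₁ a≤c with c ∸ a | m+[n∸m]≡n a≤c
  ...   | x | refl = pred-below a x c<N (trans (sym (cd-offset a x)) eq)
  cd-pred {a} {c} a<N c<N eq | inj₂ c≤a with a ∸ c | m+[n∸m]≡n c≤a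
  ...   | x | refl = pred-above c x a<N (trans (sym (cd-offset′ c x)) eq)

  cd-metric : IsPathMetric (_< N) A cd
  cd-metric = record
    { d-refl = cd-refl
    ; d-zero = cd-zero
    ; d-arc  = λ a<N b<N c<N arc → cd-arc a<N b<N c<N (A-step arc)
    ; d-pred = cd-pred
    }

  ∑-f : ∑ N f ≡ r * r
  ∑-f = begin
    ∑ N f                               ≡⟨ cong (λ m → ∑ m f) N≡r+r ⟩
    ∑ (r + r) f                         ≡⟨ ∑-split r r f ⟩
    ∑ r f + ∑ r (λ j → f (r + j))       ≡⟨ cong₂ _+_ (∑-cong r (λ k k<r → f-low (<⇒≤ k<r)))
                                                     (∑-cong r (λ j _ → trans (f-high (m≤m+n r j)) (far j))) ⟩
    ∑ r id + ∑ r (r ∸_)                 ≡⟨ cong (∑ r id +_) (trans (∑-countdown r) (∑-suc-id r)) ⟩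
    ∑ r id + (∑ r id + r)               ≡⟨ sym (+-assoc (∑ r id) _ r) ⟩
    ∑ r id + ∑ r id + r                 ≡⟨ ∑-id-double r ⟩
    r * r                               ∎
    where
    open ≡-Reasoning
    far : ∀ j → N ∸ (r + j) ≡ r ∸ j
    far j = trans (cong (_∸ (r + j)) N≡r+r) ([m+n]∸[m+o]≡n∸o r r j)

  cd-row : ∀ {x} → x < N → ∑ N (cd x) ≡ r * r
  cd-row {x} x<N = begin
    ∑ N (cd x)                                      ≡⟨ cong (λ m → ∑ m (cd x)) (sym (m+[n∸m]≡n x≤N)) ⟩
    ∑ (x + (N ∸ x)) (cd x)                          ≡⟨ ∑-split x (N ∸ x) (cd x) ⟩
    ∑ x (cd x) + ∑ (N ∸ x) (λ k → cd x (x + k))     ≡⟨ cong₂ _+_ (∑-reverse x (cd x)) (∑-cong (N ∸ x) (λ k _ → cd-offset x k)) ⟩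
    ∑ x (λ k → cd x (x ∸ suc k)) + ∑ (N ∸ x) f      ≡⟨ cong (_+ ∑ (N ∸ x) f) (∑-cong x before) ⟩
    ∑ x (λ k → f (N ∸ x + (x ∸ suc k))) + ∑ (N ∸ x) f ≡⟨ cong (_+ ∑ (N ∸ x) f) (sym (∑-reverse x (λ j → f (N ∸ x + j)))) ⟩
    ∑ x (λ j → f (N ∸ x + j)) + ∑ (N ∸ x) f         ≡⟨ +-comm _ (∑ (N ∸ x) f) ⟩
    ∑ (N ∸ x) f + ∑ x (λ j → f (N ∸ x + j))         ≡⟨ sym (∑-split (N ∸ x) x f) ⟩
    ∑ (N ∸ x + x) f                                 ≡⟨ cong (λ m → ∑ m f) (m∸n+n≡m x≤N) ⟩
    ∑ N f                                           ≡⟨ ∑-f ⟩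
    r * r                                           ∎
    where
    open ≡-Reasoning
    x≤N : x ≤ N
    x≤N = <⇒≤ x<N
    before : ∀ k → k < x → cd x (x ∸ suc k) ≡ f (N ∸ x + (x ∸ suc k))
    before k k<x = begin
      f ∣ x - x ∸ suc k ∣        ≡⟨ cong f (trans (m≤n⇒∣n-m∣≡n∸m (m∸n≤m x (suc k))) (m∸[m∸n]≡n k<x)) ⟩
      f (suc k)                  ≡⟨ sym (f-reflect (≤-trans k<x x≤N)) ⟩
      f (N ∸ suc k)              ≡⟨ cong f (sym (trans (sym (+-∸-assoc (N ∸ x) k<x)) (cong (_∸ suc k) (m∸n+n≡m x≤N)))) ⟩
      f (N ∸ x + (x ∸ suc k))    ∎

cycleIndex : GRole → ℕ
cycleIndex inA     = 0
cycleIndex inB     = 1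
cycleIndex (cyc i) = i

cycleRole : ℕ → GRole
cycleRole 0             = inA
cycleRole 1             = inB
cycleRole (suc (suc i)) = cyc (suc (suc i))

cycleAdj : ℕ → ℕ → ℕ → Bool
cycleAdj r a b = gAdjRole r (cycleRole a) (cycleRole b)

module CycleAdj (r : ℕ) (r≥2 : 2 ≤ r) where

  private
    N = 2 * r

  3≤N : 3 ≤ N
  3≤N = +-mono-≤ r≥2 (≤-trans (s≤s z≤n) (≤-trans r≥2 (m≤m+n r 0)))

  N∸1 : suc (N ∸ 1) ≡ N
  N∸1 = m+[n∸m]≡n {1} (≤-trans (s≤s z≤n) 3≤N)

  N∸1≥2 : 2 ≤ N ∸ 1
  N∸1≥2 = ∸-monoˡ-≤ 1 3≤N

  ≡ᵇ-refl : ∀ i → T (i ≡ᵇ i)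
  ≡ᵇ-refl i = ≡⇒≡ᵇ i i refl

  cycleAdj-up : ∀ a → T (cycleAdj r a (suc a))
  cycleAdj-up 0             = tt
  cycleAdj-up 1             = tt
  cycleAdj-up (suc (suc i)) = Equivalence.from T-∨ (inj₁ (≡ᵇ-refl i))

  cycleAdj-down : ∀ a → T (cycleAdj r (suc a) a)
  cycleAdj-down 0             = tt
  cycleAdj-down 1             = tt
  cycleAdj-down (suc (suc i)) = Equivalence.from T-∨ (inj₂ (≡ᵇ-refl i))

  cycleAdj-wrap-down : T (cycleAdj r 0 (N ∸ 1))
  cycleAdj-wrap-down with N ∸ 1 in e | N∸1≥2
  ... | suc (suc m) | s≤s (s≤s z≤n) = ≡⇒≡ᵇ _ _ (sym e)

  cycleAdj-wrap-up : T (cycleAdj r (N ∸ 1) 0)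
  cycleAdj-wrap-up with N ∸ 1 in e | N∸1≥2
  ... | suc (suc m) | s≤s (s≤s z≤n) = ≡⇒≡ᵇ _ _ (sym e)

  cycleAdj-step : ∀ {a b} → T (cycleAdj r a b) → CycleStep N a b
  cycleAdj-step {0}             {0}             _ = stay refl
  cycleAdj-step {0}             {1}             _ = step-up refl
  cycleAdj-step {1}             {0}             _ = step-down refl
  cycleAdj-step {1}             {1}             _ = stay refl
  cycleAdj-step {0}             {suc (suc k)}   e = wrap-down refl (trans (cong suc (≡ᵇ⇒≡ _ _ e)) N∸1)
  cycleAdj-step {suc (suc k)}   {0}             e = wrap-up (trans (cong suc (≡ᵇ⇒≡ _ _ e)) N∸1) refl
  cycleAdj-step {1}             {suc (suc k)}   e = step-up (cong (suc ∘ suc) (≡ᵇ⇒≡ k 0 e))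
  cycleAdj-step {suc (suc k)}   {1}             e = step-down (cong (suc ∘ suc) (≡ᵇ⇒≡ k 0 e))
  cycleAdj-step {suc (suc i)}   {suc (suc j)}   e with Equivalence.to T-∨ e
  ... | inj₁ j≡1+i = step-up (cong (suc ∘ suc) (≡ᵇ⇒≡ j (suc i) j≡1+i))
  ... | inj₂ i≡1+j = step-down (cong (suc ∘ suc) (≡ᵇ⇒≡ i (suc j) i≡1+j))

  open Cycle r (cycleAdj r) cycleAdj-step cycleAdj-up cycleAdj-down cycleAdj-wrap-down cycleAdj-wrap-up public

module GBlowup (n r s′ t′ : ℕ) (r≥2 : 2 ≤ r) (t-eq : cliqueSize₂ n r (suc s′) ≡ suc t′)
               (size : suc s′ + suc t′ + (2 * r ∸ 2) ≡ n) where
  open CycleAdj r r≥2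

  private
    s = suc s′
    t = suc t′
    c = 2 * r ∸ 2

  N≡2+c : N ≡ 2 + c
  N≡2+c = sym (m+[n∸m]≡n (≤-trans (s≤s (s≤s z≤n)) 3≤N))

  pos : ℕ → ℕ
  pos m = cycleIndex (gRole n r s m)

  pos₀ : ∀ {m} → m < s → pos m ≡ 0
  pos₀ m<s rewrite <ᵇ-true m<s = refl

  pos₁ : ∀ {k} → k < t → pos (s + k) ≡ 1
  pos₁ {k} k<t rewrite <ᵇ-false (m≤m+n s k) | t-eq | <ᵇ-true (+-monoʳ-< s k<t) = refl

  posρ : ∀ {k} → k < c → pos (s + t + k) ≡ 2 + k
  posρ {k} _ rewrite t-eq | <ᵇ-false (≤-trans (m≤m+n s t) (m≤m+n (s + t) k)) | <ᵇ-false (m≤m+n (s + t) k)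
                   | m+n∸m≡n (s + t) k = +-comm k 2

  open Layout pos 0 1 (2 +_) s′ t′ c n size pos₀ pos₁ posρ

  ∑-vertices : ∀ F → ∑ n (F ∘ pos) ≡ s′ * F 0 + t′ * F 1 + ∑ N F
  ∑-vertices F = trans (∑-layout F) (cong (λ m → s′ * F 0 + t′ * F 1 + ∑ m F) (sym N≡2+c))

  pos-valid : ∀ {m} → m < n → pos m < N
  pos-valid = layout-valid (_< N) (≤-trans (s≤s z≤n) 3≤N) (≤-trans (s≤s (s≤s z≤n)) 3≤N)
                           (λ {k} k<c → subst (2 + k <_) (sym N≡2+c) (s≤s (s≤s k<c)))

  pos-onto : ∀ {x} → x < N → ∃[ m ] m < n × pos m ≡ x
  pos-onto {0}           _   = layout-onto (inj₁ refl)
  pos-onto {1}           _   = layout-onto (inj₂ (inj₁ refl))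
  pos-onto {suc (suc k)} x<N = layout-onto (inj₂ (inj₂ (k , ≤-pred (≤-pred (subst (2 + k <_) N≡2+c x<N)) , refl)))

  pos-low : ∀ {m} → m < s + t → pos m < 2
  pos-low {m} m<st with m <? s
  ... | yes m<s = subst (_< 2) (sym (pos₀ m<s)) (s≤s z≤n)
  ... | no m≮s  = subst (_< 2) (sym (trans (cong pos (sym (m+[n∸m]≡n s≤m))) (pos₁ k<t))) ≤-refl
    where
    s≤m = ≮⇒≥ m≮s
    k<t = +-cancelˡ-< s (m ∸ s) t (subst (_< s + t) (sym (m+[n∸m]≡n s≤m)) m<st)

  pos-high : ∀ {m} → s + t ≤ m → m < n → pos m ≡ 2 + (m ∸ (s + t))
  pos-high {m} st≤m m<n = trans (cong pos (sym (m+[n∸m]≡n st≤m))) (posρ k<c)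
    where
    k<c = +-cancelˡ-< (s + t) (m ∸ (s + t)) c
            (subst (_< s + t + c) (sym (m+[n∸m]≡n st≤m)) (subst (m <_) (sym size) m<n))

  clique : ∀ {m m′} → m < n → m′ < n → m ≢ m′ → pos m ≡ pos m′ → T (cycleAdj r (pos m) (pos m))
  clique {m} {m′} m<n m′<n m≢m′ e with m <? s + t
  ... | yes m<st with pos m | pos-low m<st
  ...   | 0 | _ = tt
  ...   | 1 | _ = tt
  ...   | suc (suc _) | s≤s (s≤s ())
  clique {m} {m′} m<n m′<n m≢m′ e | no m≮st with m′ <? s + t
  ... | yes m′<st = ⊥-elim (<⇒≱ (pos-low m′<st) (subst (2 ≤_) (trans (sym (pos-high (≮⇒≥ m≮st) m<n)) e) (s≤s (s≤s z≤n))))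
  ... | no m′≮st  = ⊥-elim (m≢m′ (trans (sym (m∸n+n≡m (≮⇒≥ m≮st))) (trans (cong (_+ (s + t)) same) (m∸n+n≡m (≮⇒≥ m′≮st)))))
    where
    same : m ∸ (s + t) ≡ m′ ∸ (s + t)
    same = suc-injective (suc-injective (trans (sym (pos-high (≮⇒≥ m≮st) m<n)) (trans e (pos-high (≮⇒≥ m′≮st) m′<n))))

  role-index : ∀ m → cycleRole (pos m) ≡ gRole n r s m
  role-index m with m <ᵇ s
  ... | true  = refl
  ... | false with m <ᵇ s + cliqueSize₂ n r s
  ...   | true  = refl
  ...   | false = cycleRole-+2 (m ∸ (s + cliqueSize₂ n r s))
    where
    cycleRole-+2 : ∀ x → cycleRole (x + 2) ≡ cyc (x + 2)
    cycleRole-+2 x rewrite +-comm x 2 = refl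

  G-blowup : ∀ u v → G n r s u v ≡ (not ⌊ u ≟ᶠ v ⌋ ∧ cycleAdj r (pos (toℕ u)) (pos (toℕ v)))
  G-blowup u v rewrite role-index (toℕ u) | role-index (toℕ v) = refl

  cd-bounded : ∀ {x y} → x < N → y < N → cd x y ≤ n
  cd-bounded x<N y<N = ≤-trans (m⊓n≤m _ _) (≤-trans (<⇒≤ (∣-∣-< x<N y<N)) N≤n)
    where
    N≤n : N ≤ n
    N≤n = subst₂ _≤_ (sym N≡2+c) size (+-monoˡ-≤ c (+-mono-≤ (s≤s z≤n) (s≤s z≤n)))

  open Blowup _≟_ (cycleAdj r) cd (_< N) cd-metric n pos pos-valid pos-onto clique cd-bounded (G n r s) G-blowup

  d⁺-row : ∀ {x} → x < N → ∑ N (d⁺ x) ≡ r * r + 1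
  d⁺-row {x} x<N = trans (∑-distrib-+ N (cd x) _) (cong₂ _+_ (cd-row x<N) (∑-indicator-≟ N x x<N))

  d⁺-sym : ∀ x y → d⁺ x y ≡ d⁺ y x
  d⁺-sym x y = cong₂ _+_ (cd-sym x y) (cong indicator (≟-sym x y))

  d⁺-ends : ∀ {x y} → x < 2 → y < 2 → d⁺ x y ≡ 1
  d⁺-ends {0} {0} _ _ = refl
  d⁺-ends {0} {1} _ _ = cong (_+ 0) (f-low (≤-trans (s≤s z≤n) r≥2))
  d⁺-ends {1} {0} _ _ = cong (_+ 0) (f-low (≤-trans (s≤s z≤n) r≥2))
  d⁺-ends {1} {1} _ _ = refl
  d⁺-ends {suc (suc _)} (s≤s (s≤s ())) _
  d⁺-ends {_} {suc (suc _)} _ (s≤s (s≤s ()))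

  ∑-column : ∀ {y} → y < 2 → ∑ n (λ a → d⁺ (pos a) y) ≡ s′ + t′ + (r * r + 1)
  ∑-column {y} y<2 = begin
    ∑ n (λ a → d⁺ (pos a) y)                       ≡⟨ ∑-vertices (λ x → d⁺ x y) ⟩
    s′ * d⁺ 0 y + t′ * d⁺ 1 y + ∑ N (λ x → d⁺ x y) ≡⟨ cong₂ _+_ (cong₂ _+_ (ends s′ z<s) (ends t′ (s<s z<s)))
                                                                (trans (∑-cong N (λ x _ → d⁺-sym x y)) (d⁺-row y<N)) ⟩
    s′ + t′ + (r * r + 1)                          ∎
    where
    open ≡-Reasoning
    ends : ∀ k {x} → x < 2 → k * d⁺ x y ≡ k
    ends k x<2 = trans (cong (k *_) (d⁺-ends x<2 y<2)) (*-identityʳ k)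
    y<N = <-≤-trans y<2 (≤-trans (n≤1+n 2) 3≤N)

  WienerG-G : WienerG (G n r s) + WienerG (G n r s) + n ≡
    s′ * (s′ + t′ + (r * r + 1)) + t′ * (s′ + t′ + (r * r + 1)) + n * (r * r + 1)
  WienerG-G = trans (WienerG-blowup cd-sym) (begin
    ∑ n (λ a → ∑ n (λ b → d⁺ (pos a) (pos b)))
      ≡⟨ ∑-cong n (λ a a<n → trans (∑-vertices (d⁺ (pos a)))
                              (cong (s′ * d⁺ (pos a) 0 + t′ * d⁺ (pos a) 1 +_) (d⁺-row (pos-valid a<n)))) ⟩
    ∑ n (λ a → s′ * d⁺ (pos a) 0 + t′ * d⁺ (pos a) 1 + (r * r + 1))
      ≡⟨ trans (∑-distrib-+ n _ _) (cong₂ _+_ (trans (∑-distrib-+ n _ _)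
                                                (cong₂ _+_ (∑-distribˡ-* n s′ _) (∑-distribˡ-* n t′ _)))
                                              (∑-const n _)) ⟩
    s′ * ∑ n (λ a → d⁺ (pos a) 0) + t′ * ∑ n (λ a → d⁺ (pos a) 1) + n * (r * r + 1)
      ≡⟨ cong₂ (λ x y → s′ * x + t′ * y + n * (r * r + 1)) (∑-column z<s) (∑-column (s<s z<s)) ⟩
    s′ * (s′ + t′ + (r * r + 1)) + t′ * (s′ + t′ + (r * r + 1)) + n * (r * r + 1) ∎)
    where open ≡-Reasoning

≡ᵇ-false : ∀ {a b} → a ≢ b → (a ≡ᵇ b) ≡ false
≡ᵇ-false {a} {b} a≢b with a ≡ᵇ b in eq
... | true  = ⊥-elim (a≢b (≡ᵇ⇒≡ a b (Equivalence.from T-≡ eq)))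
... | false = refl

T≤ᵇ⇒≤ : ∀ {a b} → T (a ≤ᵇ b) → a ≤ b
T≤ᵇ⇒≤ {a} {b} t = ≤-pred (<ᵇ⇒< a (suc b) t)

≤⇒T≤ᵇ : ∀ {a b} → a ≤ b → T (a ≤ᵇ b)
≤⇒T≤ᵇ a≤b = <⇒<ᵇ (s≤s a≤b)

-- distance from x_i to x_j inside one side of D_{2r,r,1}: climb one arc at a time, or jump back in one arc
sideDist : ℕ → ℕ → ℕ
sideDist i j = if i <ᵇ j then j ∸ i else if j ≡ᵇ i then 0 else 1

sideDist-< : ∀ {i j} → i < j → sideDist i j ≡ j ∸ i
sideDist-< i<j rewrite <ᵇ-true i<j = refl

sideDist-self : ∀ i → sideDist i i ≡ 0
sideDist-self i rewrite <ᵇ-false (≤-refl {i}) | Equivalence.to T-≡ (≡⇒≡ᵇ i i refl) = refl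

sideDist-> : ∀ {i j} → j < i → sideDist i j ≡ 1
sideDist-> {i} {j} j<i rewrite <ᵇ-false (<⇒≤ j<i) | ≡ᵇ-false (<⇒≢ j<i) = refl

sideDist-up : ∀ i k → sideDist i (i + k) ≡ k
sideDist-up i zero    = trans (cong (sideDist i) (+-identityʳ i)) (sideDist-self i)
sideDist-up i (suc k) = trans (sideDist-< (m<m+n i z<s)) (m+n∸m≡n i (suc k))

sideDist-zero : ∀ {i j} → sideDist i j ≡ 0 → i ≡ j
sideDist-zero {i} {j} eq with <-cmp i j
... | tri< i<j _ _ = ⊥-elim (<⇒≱ i<j (m∸n≡0⇒m≤n (trans (sym (sideDist-< i<j)) eq)))
... | tri≈ _ i≡j _ = i≡j
... | tri> _ _ j<i = case trans (sym (sideDist-> j<i)) eq of λ ()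

sideDist-≤ : ∀ i {j} → 1 ≤ j → sideDist i j ≤ j
sideDist-≤ i {j} 1≤j with <-cmp i j
... | tri< i<j _ _  = ≤-trans (≤-reflexive (sideDist-< i<j)) (m∸n≤m j i)
... | tri≈ _ refl _ = ≤-trans (≤-reflexive (sideDist-self i)) z≤n
... | tri> _ _ j<i  = ≤-trans (≤-reflexive (sideDist-> j<i)) 1≤j

sideDist-arc : ∀ i {j l} → l ≤ suc j → sideDist i l ≤ suc (sideDist i j)
sideDist-arc i {j} {l} l≤sj with <-cmp i l
... | tri< i<l _ _  = begin
  sideDist i l        ≡⟨ sideDist-< i<l ⟩
  l ∸ i               ≤⟨ ∸-monoˡ-≤ i l≤sj ⟩
  suc j ∸ i           ≡⟨ +-∸-assoc 1 (≤-pred (≤-trans i<l l≤sj)) ⟩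
  suc (j ∸ i)         ≤⟨ s≤s (∸≤sideDist j) ⟩
  suc (sideDist i j)  ∎
  where
  open ≤-Reasoning
  ∸≤sideDist : ∀ j → j ∸ i ≤ sideDist i j
  ∸≤sideDist j with <-cmp i j
  ... | tri< i<j _ _ = ≤-reflexive (sym (sideDist-< i<j))
  ... | tri≈ _ i≡j _ = ≤-trans (≤-reflexive (m≤n⇒m∸n≡0 (≤-reflexive (sym i≡j)))) z≤n
  ... | tri> _ _ j<i = ≤-trans (≤-reflexive (m≤n⇒m∸n≡0 (<⇒≤ j<i))) z≤n
... | tri≈ _ refl _ = ≤-trans (≤-reflexive (sideDist-self i)) z≤n
... | tri> _ _ l<i  = ≤-trans (≤-reflexive (sideDist-> l<i)) (s≤s z≤n)

sideDistTotal : ℕ → ℕ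
sideDistTotal r = ∑ r (λ i → ∑ r (sideDist i))

sideDistTotal-suc : ∀ r → sideDistTotal (suc r) ≡ sideDistTotal r + ∑ r suc + r
sideDistTotal-suc r = begin
  ∑ (suc r) (λ i → ∑ (suc r) (sideDist i))
    ≡⟨ ∑-suc r _ ⟩
  ∑ r (λ i → ∑ (suc r) (sideDist i)) + ∑ (suc r) (sideDist r)
    ≡⟨ cong₂ _+_ (trans (∑-cong r (λ i _ → ∑-suc r (sideDist i))) (∑-distrib-+ r _ _)) (∑-suc r (sideDist r)) ⟩
  (sideDistTotal r + ∑ r (λ i → sideDist i r)) + (∑ r (sideDist r) + sideDist r r)
    ≡⟨ cong₂ _+_ (cong (sideDistTotal r +_) (trans (∑-cong r (λ i i<r → sideDist-< i<r)) (∑-countdown r)))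
                 (cong₂ _+_ (trans (∑-cong r (λ j j<r → sideDist-> j<r)) (trans (∑-const r 1) (*-identityʳ r)))
                            (sideDist-self r)) ⟩
  (sideDistTotal r + ∑ r suc) + (r + 0)
    ≡⟨ cong (sideDistTotal r + ∑ r suc +_) (+-identityʳ r) ⟩
  sideDistTotal r + ∑ r suc + r ∎
  where open ≡-Reasoning

sideDistTotal-closed : ∀ r → sideDistTotal r * 6 + 4 * r ≡ r * r * r + 3 * (r * r)
sideDistTotal-closed zero    = refl
sideDistTotal-closed (suc r) = begin
  sideDistTotal (suc r) * 6 + 4 * suc r
    ≡⟨ cong (λ x → x * 6 + 4 * suc r) (sideDistTotal-suc r) ⟩
  (sideDistTotal r + ∑ r suc + r) * 6 + 4 * suc r
    ≡⟨ regroup (sideDistTotal r) (∑ r suc) r ⟩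
  (sideDistTotal r * 6 + 4 * r) + 3 * (∑ r suc + ∑ r suc) + 6 * r + 4
    ≡⟨ cong₂ (λ x y → x + 3 * y + 6 * r + 4) (sideDistTotal-closed r) (∑-suc-double r) ⟩
  r * r * r + 3 * (r * r) + 3 * (r * r + r) + 6 * r + 4
    ≡⟨ cube r ⟩
  suc r * suc r * suc r + 3 * (suc r * suc r) ∎
  where
  open ≡-Reasoning
  regroup : ∀ d u r → (d + u + r) * 6 + 4 * suc r ≡ (d * 6 + 4 * r) + 3 * (u + u) + 6 * r + 4
  regroup = solve-∀
  cube : ∀ r → r * r * r + 3 * (r * r) + 3 * (r * r + r) + 6 * r + 4 ≡ suc r * suc r * suc r + 3 * (suc r * suc r)
  cube = solve-∀

C2-double : ∀ n → n C 2 + n C 2 + n ≡ n * n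
C2-double zero    = refl
C2-double (suc n) = begin
  suc n C 2 + suc n C 2 + suc n         ≡⟨ cong (λ x → x + x + suc n) (sym pascal) ⟩
  (n + n C 2) + (n + n C 2) + suc n     ≡⟨ regroup n (n C 2) ⟩
  (n C 2 + n C 2 + n) + (n + n + 1)     ≡⟨ cong (_+ (n + n + 1)) (C2-double n) ⟩
  n * n + (n + n + 1)                   ≡⟨ square n ⟩
  suc n * suc n                         ∎
  where
  open ≡-Reasoning
  pascal : n + n C 2 ≡ suc n C 2
  pascal = trans (cong (_+ n C 2) (sym (nC1≡n n))) (nCk+nC[k+1]≡[n+1]C[k+1] n 1)
  regroup : ∀ n x → (n + x) + (n + x) + suc n ≡ (x + x + n) + (n + n + 1)
  regroup = solve-∀
  square : ∀ n → n * n + (n + n + 1) ≡ suc n * suc n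
  square = solve-∀

C3-closed : ∀ r → (r C 3) * 6 + 3 * (r * r) ≡ r * r * r + 2 * r
C3-closed zero    = refl
C3-closed (suc r) = +-cancelʳ-≡ (3 * r) _ _ (begin
  (suc r C 3) * 6 + 3 * (suc r * suc r) + 3 * r
    ≡⟨ cong (λ x → x * 6 + 3 * (suc r * suc r) + 3 * r) (sym (nCk+nC[k+1]≡[n+1]C[k+1] r 2)) ⟩
  (r C 2 + r C 3) * 6 + 3 * (suc r * suc r) + 3 * r
    ≡⟨ regroup (r C 2) (r C 3) r ⟩
  3 * (r C 2 + r C 2 + r) + ((r C 3) * 6 + 3 * (r * r)) + (6 * r + 3)
    ≡⟨ cong₂ (λ x y → 3 * x + y + (6 * r + 3)) (C2-double r) (C3-closed r) ⟩
  3 * (r * r) + (r * r * r + 2 * r) + (6 * r + 3)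
    ≡⟨ cube r ⟩
  suc r * suc r * suc r + 2 * suc r + 3 * r ∎)
  where
  open ≡-Reasoning
  regroup : ∀ x y r → (x + y) * 6 + 3 * (suc r * suc r) + 3 * r ≡ 3 * (x + x + r) + (y * 6 + 3 * (r * r)) + (6 * r + 3)
  regroup = solve-∀
  cube : ∀ r → 3 * (r * r) + (r * r * r + 2 * r) + (6 * r + 3) ≡ suc r * suc r * suc r + 2 * suc r + 3 * r
  cube = solve-∀

DValid : ℕ → DRole → Set
DValid r (role _ i) = 1 ≤ i × i ≤ r

dDist : DRole → DRole → ℕ
dDist (role false i) (role false j) = sideDist i j
dDist (role true  i) (role true  j) = sideDist i j
dDist (role false _) (role true  j) = j
dDist (role true  _) (role false j) = j

_≟ᴿ_ : DecidableEquality DRole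
role x i ≟ᴿ role y j =
  map′ (λ (x≡y , i≡j) → cong₂ role x≡y i≡j) (λ { refl → refl , refl }) ((x ≟ᴮ y) ×-dec (i ≟ j))

dDist-refl : ∀ x → dDist x x ≡ 0
dDist-refl (role false i) = sideDist-self i
dDist-refl (role true  i) = sideDist-self i

dDist-zero : ∀ {r x y} → DValid r y → dDist x y ≡ 0 → x ≡ y
dDist-zero {x = role false i} {role false j} _ eq = cong (role false) (sideDist-zero eq)
dDist-zero {x = role true  i} {role true  j} _ eq = cong (role true) (sideDist-zero eq)
dDist-zero {x = role false i} {role true  j} (1≤j , _) refl = case 1≤j of λ ()
dDist-zero {x = role true  i} {role false j} (1≤j , _) refl = case 1≤j of λ ()

dDist-to-first : ∀ x b → dDist x (role b 1) ≤ 1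
dDist-to-first (role false i) false = sideDist-≤ i ≤-refl
dDist-to-first (role true  i) true  = sideDist-≤ i ≤-refl
dDist-to-first (role false i) true  = ≤-refl
dDist-to-first (role true  i) false = ≤-refl

dDist-arc : ∀ a {b c} → T (dArcRole b c) → dDist a c ≤ suc (dDist a b)
dDist-arc a {role false j} {role true  l} arc rewrite ≡ᵇ⇒≡ l 1 arc = ≤-trans (dDist-to-first a true) (s≤s z≤n)
dDist-arc a {role true  j} {role false l} arc rewrite ≡ᵇ⇒≡ l 1 arc = ≤-trans (dDist-to-first a false) (s≤s z≤n)
dDist-arc (role false i) {role false j} {role false l} arc = sideDist-arc i {j} {l} (T≤ᵇ⇒≤ {l} arc)
dDist-arc (role true  i) {role true  j} {role true  l} arc = sideDist-arc i {j} {l} (T≤ᵇ⇒≤ {l} arc)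
dDist-arc (role true  i) {role false j} {role false l} arc = T≤ᵇ⇒≤ {l} arc
dDist-arc (role false i) {role true  j} {role true  l} arc = T≤ᵇ⇒≤ {l} arc

sideDist-pred : ∀ {r i l k} → 1 ≤ i → i ≤ r → l ≤ r → sideDist i l ≡ suc k →
                ∃[ j ] (1 ≤ j × j ≤ r) × sideDist i j ≡ k × T (l ≤ᵇ suc j)
sideDist-pred {r} {i} {l} {k} 1≤i i≤r l≤r eq with <-cmp i l
... | tri< i<l _ _  = i + k , (≤-trans 1≤i (m≤m+n i k) , ≤-trans (<⇒≤ (subst (i + k <_) (sym l≡) (+-monoʳ-< i (n<1+n k)))) l≤r) ,
                      sideDist-up i k , ≤⇒T≤ᵇ (≤-reflexive (trans l≡ (+-suc i k)))
  where
  l≡ : l ≡ i + suc k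
  l≡ = trans (sym (m+[n∸m]≡n (<⇒≤ i<l))) (cong (i +_) (trans (sym (sideDist-< i<l)) eq))
... | tri≈ _ refl _ = case trans (sym (sideDist-self i)) eq of λ ()
... | tri> _ _ l<i  with trans (sym (sideDist-> l<i)) eq
...   | refl = i , (1≤i , i≤r) , sideDist-self i , ≤⇒T≤ᵇ (m≤n⇒m≤1+n (<⇒≤ l<i))

dDist-pred : ∀ {r x z k} → DValid r x → DValid r z → dDist x z ≡ suc k →
             ∃[ y ] DValid r y × dDist x y ≡ k × T (dArcRole y z)
dDist-pred {r} {role false i} {role false l} (1≤i , i≤r) (_ , l≤r) eq with sideDist-pred {r} {i} {l} 1≤i i≤r l≤r eq
... | j , valid , d , arc = role false j , valid , d , arc
dDist-pred {r} {role true  i} {role true  l} (1≤i , i≤r) (_ , l≤r) eq with sideDist-pred {r} {i} {l} 1≤i i≤r l≤r eq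
... | j , valid , d , arc = role true j , valid , d , arc
dDist-pred {x = role false i} {role true (suc zero)}     valid _ refl = role false i , valid , sideDist-self i , tt
dDist-pred {x = role true  i} {role false (suc zero)}    valid _ refl = role true i , valid , sideDist-self i , tt
dDist-pred {x = role false i} {role true (suc (suc k))}  _ (_ , l≤r) refl =
  role true (suc k) , (s≤s z≤n , ≤-trans (n≤1+n _) l≤r) , refl , ≤⇒T≤ᵇ (≤-refl {suc (suc k)})
dDist-pred {x = role true  i} {role false (suc (suc k))} _ (_ , l≤r) refl =
  role false (suc k) , (s≤s z≤n , ≤-trans (n≤1+n _) l≤r) , refl , ≤⇒T≤ᵇ (≤-refl {suc (suc k)})

dDist-metric : ∀ r → IsPathMetric (DValid r) dArcRole dDist
dDist-metric r = record
  { d-refl = dDist-refl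
  ; d-zero = λ {x} {y} _ valid-y → dDist-zero {r} {x} {y} valid-y
  ; d-arc  = λ {x} _ _ _ → dDist-arc x
  ; d-pred = λ {x} → dDist-pred {r} {x}
  }

dDist-bounded : ∀ {r x y} → DValid r x → DValid r y → dDist x y ≤ r
dDist-bounded {x = role false i} {role false j} _ (1≤j , j≤r) = ≤-trans (sideDist-≤ i 1≤j) j≤r
dDist-bounded {x = role true  i} {role true  j} _ (1≤j , j≤r) = ≤-trans (sideDist-≤ i 1≤j) j≤r
dDist-bounded {x = role false i} {role true  j} _ (_ , j≤r)   = j≤r
dDist-bounded {x = role true  i} {role false j} _ (_ , j≤r)   = j≤r

∑ᴿ : ℕ → (DRole → ℕ) → ℕ
∑ᴿ r F = ∑ r (λ i → F (role false (suc i))) + ∑ r (λ i → F (role true (suc i)))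

∑ᴿ-cong : ∀ r {F G : DRole → ℕ} → (∀ {x} → DValid r x → F x ≡ G x) → ∑ᴿ r F ≡ ∑ᴿ r G
∑ᴿ-cong r e = cong₂ _+_ (∑-cong r (λ _ i<r → e (s≤s z≤n , i<r))) (∑-cong r (λ _ i<r → e (s≤s z≤n , i<r)))

∑ᴿ-distrib-+ : ∀ r (F G : DRole → ℕ) → ∑ᴿ r (λ x → F x + G x) ≡ ∑ᴿ r F + ∑ᴿ r G
∑ᴿ-distrib-+ r F G = trans (cong₂ _+_ (∑-distrib-+ r (F ∘ role false ∘ suc) (G ∘ role false ∘ suc))
                                        (∑-distrib-+ r (F ∘ role true ∘ suc) (G ∘ role true ∘ suc)))
                            (+-interchange (∑ r (F ∘ role false ∘ suc)) (∑ r (G ∘ role false ∘ suc))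
                                           (∑ r (F ∘ role true ∘ suc)) (∑ r (G ∘ role true ∘ suc)))

≟ᴿ-same : ∀ b i j → ⌊ role b i ≟ᴿ role b j ⌋ ≡ ⌊ i ≟ j ⌋
≟ᴿ-same b i j = ⌊⌋-⇔ (mk⇔ (λ { refl → refl }) (cong (role b))) (role b i ≟ᴿ role b j) (i ≟ j)

∑ᴿ-indicator : ∀ {r x} → DValid r x → ∑ᴿ r (λ y → indicator ⌊ x ≟ᴿ y ⌋) ≡ 1
∑ᴿ-indicator {suc r} {role false (suc i)} (_ , s≤s i≤r) =
  cong₂ _+_ (trans (∑-cong (suc r) (λ j _ → cong indicator (trans (≟ᴿ-same false (suc i) (suc j)) (≟-suc i j))))
                   (∑-indicator-≟ (suc r) i (s≤s i≤r)))
            (∑-zero (suc r) (λ _ _ → refl))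
∑ᴿ-indicator {suc r} {role true (suc i)} (_ , s≤s i≤r) =
  trans (cong₂ _+_ (∑-zero (suc r) (λ _ _ → refl))
                   (trans (∑-cong (suc r) (λ j _ → cong indicator (trans (≟ᴿ-same true (suc i) (suc j)) (≟-suc i j))))
                          (∑-indicator-≟ (suc r) i (s≤s i≤r)))) refl

dArc-refl : ∀ x → T (dArcRole x x)
dArc-refl (role false i) = ≤⇒T≤ᵇ (n≤1+n i)
dArc-refl (role true  i) = ≤⇒T≤ᵇ (n≤1+n i)

module DBlowup (n q s′ t′ : ℕ) (t-eq : cliqueSize₂ n (suc q) (suc s′) ≡ suc t′)
               (size : suc s′ + suc t′ + (q + q) ≡ n) where

  private
    r = suc q
    s = suc s′
    t = suc t′
    c = q + q

  v₁ w₁ : DRole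
  v₁ = role false 1
  w₁ = role true 1

  ρ : ℕ → DRole
  ρ k = if k <ᵇ q then role false (2 + k) else role true (2 + (k ∸ q))

  ρ-low : ∀ {k} → k < q → ρ k ≡ role false (2 + k)
  ρ-low k<q rewrite <ᵇ-true k<q = refl

  ρ-high : ∀ k → ρ (q + k) ≡ role true (2 + k)
  ρ-high k rewrite <ᵇ-false (m≤m+n q k) | m+n∸m≡n q k = refl

  pos : ℕ → DRole
  pos = dRole n r s

  pos₀ : ∀ {m} → m < s → pos m ≡ v₁
  pos₀ m<s rewrite <ᵇ-true m<s = refl

  pos₁ : ∀ {k} → k < t → pos (s + k) ≡ w₁
  pos₁ {k} k<t rewrite <ᵇ-false (m≤m+n s k) | t-eq | <ᵇ-true (+-monoʳ-< s k<t) = refl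

  posρ : ∀ {k} → k < c → pos (s + t + k) ≡ ρ k
  posρ {k} _ rewrite t-eq | <ᵇ-false (≤-trans (m≤m+n s t) (m≤m+n (s + t) k)) | <ᵇ-false (m≤m+n (s + t) k)
                   | m+n∸m≡n (s + t) k with k <ᵇ q
  ... | true  = cong (role false) (+-comm k 2)
  ... | false = cong (role true) (+-comm (k ∸ q) 2)

  open Layout pos v₁ w₁ ρ s′ t′ c n size pos₀ pos₁ posρ

  ∑-vertices : ∀ F → ∑ n (F ∘ pos) ≡ s′ * F v₁ + t′ * F w₁ + ∑ᴿ r F
  ∑-vertices F = trans (∑-layout F) (cong (s′ * F v₁ + t′ * F w₁ +_) (begin
    F v₁ + (F w₁ + ∑ (q + q) (F ∘ ρ))
      ≡⟨ cong (λ m → F v₁ + (F w₁ + m)) (∑-split q q (F ∘ ρ)) ⟩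
    F v₁ + (F w₁ + (∑ q (F ∘ ρ) + ∑ q (λ k → F (ρ (q + k)))))
      ≡⟨ cong (λ m → F v₁ + (F w₁ + m)) (cong₂ _+_ (∑-cong q (λ _ k<q → cong F (ρ-low k<q)))
                                                    (∑-cong q (λ k _ → cong F (ρ-high k)))) ⟩
    F v₁ + (F w₁ + (∑ q (λ k → F (role false (2 + k))) + ∑ q (λ k → F (role true (2 + k)))))
      ≡⟨ shuffle (F v₁) (F w₁) _ _ ⟩
    ∑ᴿ r F ∎))
    where
    open ≡-Reasoning
    shuffle : ∀ a b x y → a + (b + (x + y)) ≡ (a + x) + (b + y)
    shuffle = solve-∀

  ρ-valid : ∀ {k} → k < c → DValid r (ρ k)
  ρ-valid {k} k<c with k <? q
  ... | yes k<q = subst (DValid r) (sym (ρ-low k<q)) (s≤s z≤n , s≤s k<q)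
  ... | no k≮q  = subst (DValid r) (sym (trans (cong ρ (sym (m+[n∸m]≡n q≤k))) (ρ-high (k ∸ q))))
                        (s≤s z≤n , s≤s j<q)
    where
    q≤k = ≮⇒≥ k≮q
    j<q = +-cancelˡ-< q (k ∸ q) q (subst (_< q + q) (sym (m+[n∸m]≡n q≤k)) k<c)

  pos-valid : ∀ {m} → m < n → DValid r (pos m)
  pos-valid = layout-valid (DValid r) (≤-refl , s≤s z≤n) (≤-refl , s≤s z≤n) ρ-valid

  pos-onto : ∀ {x} → DValid r x → ∃[ m ] m < n × pos m ≡ x
  pos-onto {role false 1}             _                  = layout-onto (inj₁ refl)
  pos-onto {role true  1}             _                  = layout-onto (inj₂ (inj₁ refl))
  pos-onto {role false (suc (suc j))} (_ , s≤s j<q) =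
    layout-onto (inj₂ (inj₂ (j , ≤-trans j<q (m≤m+n q q) , ρ-low j<q)))
  pos-onto {role true  (suc (suc j))} (_ , s≤s j<q) =
    layout-onto (inj₂ (inj₂ (q + j , +-monoʳ-< q j<q , ρ-high j)))

  r≤n : r ≤ n
  r≤n = subst (r ≤_) size (≤-trans (s≤s (m≤m+n q q)) (+-monoˡ-≤ c (≤-trans (s≤s z≤n) (m≤m+n s t))))

  open Blowup _≟ᴿ_ dArcRole dDist (DValid r) (dDist-metric r) n pos pos-valid pos-onto
              (λ {m} _ _ _ _ → dArc-refl (pos m)) (λ {x} {y} valid-x valid-y → ≤-trans (dDist-bounded {r} {x} {y} valid-x valid-y) r≤n)
              (D n r s) (λ _ _ → refl)

  d⁺-to-first : ∀ b {x} → DValid r x → d⁺ x (role b 1) ≡ 1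
  d⁺-to-first false {role false (suc zero)}    _ = refl
  d⁺-to-first false {role false (suc (suc _))} _ = refl
  d⁺-to-first false {role true  (suc zero)}    _ = refl
  d⁺-to-first false {role true  (suc (suc _))} _ = refl
  d⁺-to-first true  {role false (suc zero)}    _ = refl
  d⁺-to-first true  {role false (suc (suc _))} _ = refl
  d⁺-to-first true  {role true  (suc zero)}    _ = refl
  d⁺-to-first true  {role true  (suc (suc _))} _ = refl

  ∑-column : ∀ b → ∑ n (λ a → d⁺ (pos a) (role b 1)) ≡ n
  ∑-column b = trans (∑-cong n (λ a a<n → d⁺-to-first b {pos a} (pos-valid a<n))) (trans (∑-const n 1) (*-identityʳ n))

  row : ∀ {x} → DValid r x → ∑ᴿ r (d⁺ x) ≡ ∑ᴿ r (dDist x) + 1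
  row {x} valid-x = trans (∑ᴿ-distrib-+ r (dDist x) (λ y → indicator ⌊ x ≟ᴿ y ⌋))
                          (cong (∑ᴿ r (dDist x) +_) (∑ᴿ-indicator {r} {x} valid-x))

  ∑-id+∑-suc : ∑ r id + ∑ r suc ≡ r * r
  ∑-id+∑-suc = trans (cong (∑ r id +_) (∑-suc-id r)) (trans (sym (+-assoc (∑ r id) _ r)) (∑-id-double r))

  row-v₁ : ∑ᴿ r (d⁺ v₁) ≡ r * r + 1
  row-v₁ = trans (row {v₁} (≤-refl , s≤s z≤n)) (cong (_+ 1) ∑-id+∑-suc)

  row-w₁ : ∑ᴿ r (d⁺ w₁) ≡ r * r + 1
  row-w₁ = trans (row {w₁} (≤-refl , s≤s z≤n)) (cong (_+ 1) (trans (+-comm (∑ r suc) (∑ r id)) ∑-id+∑-suc))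

  ∑ᴿ-dDist : ∑ᴿ r (λ x → ∑ᴿ r (dDist x)) ≡ (sideDistTotal r + r * ∑ r suc) + (r * ∑ r suc + sideDistTotal r)
  ∑ᴿ-dDist = cong₂ _+_ (trans (∑-distrib-+ r (λ i → ∑ r (sideDist i)) (λ _ → ∑ r suc)) (cong (sideDistTotal r +_) (∑-const r (∑ r suc))))
                       (trans (∑-distrib-+ r (λ _ → ∑ r suc) (λ i → ∑ r (sideDist i))) (cong (_+ sideDistTotal r) (∑-const r (∑ r suc))))

  WienerD-D : WienerD (D n r s) + n ≡
    s′ * n + t′ * n + (s′ * (r * r + 1) + t′ * (r * r + 1) + ((sideDistTotal r + r * ∑ r suc) + (r * ∑ r suc + sideDistTotal r) + (r * 1 + r * 1)))
  WienerD-D = trans WienerD-blowup (begin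
    ∑ n (λ a → ∑ n (λ b → d⁺ (pos a) (pos b)))
      ≡⟨ ∑-cong n (λ a _ → ∑-vertices (d⁺ (pos a))) ⟩
    ∑ n (λ a → s′ * d⁺ (pos a) v₁ + t′ * d⁺ (pos a) w₁ + Row (pos a))
      ≡⟨ trans (∑-distrib-+ n _ _) (cong (_+ ∑ n (Row ∘ pos)) (trans (∑-distrib-+ n _ _)
                 (cong₂ _+_ (∑-distribˡ-* n s′ _) (∑-distribˡ-* n t′ _)))) ⟩
    s′ * ∑ n (λ a → d⁺ (pos a) v₁) + t′ * ∑ n (λ a → d⁺ (pos a) w₁) + ∑ n (Row ∘ pos)
      ≡⟨ cong₂ _+_ (cong₂ (λ x y → s′ * x + t′ * y) (∑-column false) (∑-column true)) (∑-vertices Row) ⟩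
    s′ * n + t′ * n + (s′ * Row v₁ + t′ * Row w₁ + ∑ᴿ r Row)
      ≡⟨ cong (s′ * n + t′ * n +_) (cong₂ _+_ (cong₂ (λ x y → s′ * x + t′ * y) row-v₁ row-w₁) ∑ᴿ-Row) ⟩
    s′ * n + t′ * n + (s′ * (r * r + 1) + t′ * (r * r + 1) + ((sideDistTotal r + r * ∑ r suc) + (r * ∑ r suc + sideDistTotal r) + (r * 1 + r * 1))) ∎)
    where
    open ≡-Reasoning
    Row : DRole → ℕ
    Row x = ∑ᴿ r (d⁺ x)
    ∑ᴿ-Row : ∑ᴿ r Row ≡ (sideDistTotal r + r * ∑ r suc) + (r * ∑ r suc + sideDistTotal r) + (r * 1 + r * 1)
    ∑ᴿ-Row = trans (∑ᴿ-cong r (λ {x} → row {x})) (trans (∑ᴿ-distrib-+ r (λ x → ∑ᴿ r (dDist x)) (λ _ → 1))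
                   (cong₂ _+_ ∑ᴿ-dDist (cong₂ _+_ (∑-const r 1) (∑-const r 1))))

cliqueSizes : ∀ n q s → 2 * suc q ≤ n → 2 * s ≤ n + 2 ∸ 2 * suc q →
              s ≤ cliqueSize₂ n (suc q) s × s + cliqueSize₂ n (suc q) s + (q + q) ≡ n
cliqueSizes n q s 2r≤n 2s≤m = s≤t , trans (cong (_+ (q + q)) s+t≡m) m+2q≡n
  where
  m = n + 2 ∸ 2 * suc q
  2r≡ : 2 * suc q ≡ 2 + (q + q)
  2r≡ = cong suc (trans (cong (q +_) (+-identityʳ (suc q))) (+-suc q q))
  m+2q≡n : m + (q + q) ≡ n
  m+2q≡n = begin
    n + 2 ∸ 2 * suc q + (q + q)     ≡⟨ cong₂ (λ x y → x ∸ y + (q + q)) (+-comm n 2) 2r≡ ⟩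
    2 + n ∸ (2 + (q + q)) + (q + q) ≡⟨ cong (_+ (q + q)) ([m+n]∸[m+o]≡n∸o 2 n (q + q)) ⟩
    n ∸ (q + q) + (q + q)           ≡⟨ m∸n+n≡m (≤-trans (m≤n+m (q + q) 2) (subst (_≤ n) 2r≡ 2r≤n)) ⟩
    n                               ∎
    where open ≡-Reasoning
  s+s≤m : s + s ≤ m
  s+s≤m = subst (_≤ m) (cong (s +_) (+-identityʳ s)) 2s≤m
  s+t≡m : s + (m ∸ s) ≡ m
  s+t≡m = m+[n∸m]≡n (≤-trans (m≤m+n s s) s+s≤m)
  s≤t : s ≤ m ∸ s
  s≤t = +-cancelˡ-≤ s s (m ∸ s) (subst (s + s ≤_) (sym s+t≡m) s+s≤m)

+-double-injective : ∀ x y n → x + x + n ≡ y + y + n → x ≡ y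
+-double-injective x y n eq = *-cancelˡ-≡ x y 2 (trans (double x) (trans (+-cancelʳ-≡ n _ _ eq) (sym (double y))))
  where
  double : ∀ x → 2 * x ≡ x + x
  double = solve-∀

WienerG-arithmetic : ∀ s′ t′ q n W → n ≡ suc s′ + suc t′ + (q + q) →
  W + W + n ≡ s′ * (s′ + t′ + (suc q * suc q + 1)) + t′ * (s′ + t′ + (suc q * suc q + 1)) + n * (suc q * suc q + 1) →
  W + suc q * q ^ 2 ≡ n C 2 + q ^ 2 * n
WienerG-arithmetic s′ t′ q n W refl hW = +-double-injective _ _ n (begin
  (W + A) + (W + A) + n ≡⟨ shuffle W A n ⟩
  (W + W + n) + (A + A) ≡⟨ cong (_+ (A + A)) hW ⟩
  s′ * (s′ + t′ + (suc q * suc q + 1)) + t′ * (s′ + t′ + (suc q * suc q + 1)) + n * (suc q * suc q + 1) + (A + A)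
                        ≡⟨ polynomial s′ t′ q ⟩
  n * n + (B + B)       ≡⟨ cong (_+ (B + B)) (sym (C2-double n)) ⟩
  (n C 2 + n C 2 + n) + (B + B) ≡⟨ sym (shuffle (n C 2) B n) ⟩
  (n C 2 + B) + (n C 2 + B) + n ∎)
  where
  open ≡-Reasoning
  A = suc q * q ^ 2
  B = q ^ 2 * n
  shuffle : ∀ w a n → (w + a) + (w + a) + n ≡ (w + w + n) + (a + a)
  shuffle = solve-∀
  polynomial : ∀ s′ t′ q →
    s′ * (s′ + t′ + (suc q * suc q + 1)) + t′ * (s′ + t′ + (suc q * suc q + 1)) + (suc s′ + suc t′ + (q + q)) * (suc q * suc q + 1)
      + (suc q * (q * (q * 1)) + suc q * (q * (q * 1)))
      ≡ (suc s′ + suc t′ + (q + q)) * (suc s′ + suc t′ + (q + q)) + (q * (q * 1) * (suc s′ + suc t′ + (q + q)) + q * (q * 1) * (suc s′ + suc t′ + (q + q)))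
  polynomial = solve-∀

WienerD-arithmetic : ∀ s′ t′ q n W SD S₁ C₃ → n ≡ suc s′ + suc t′ + (q + q) →
  let r = suc q in
  W + n ≡ s′ * n + t′ * n + (s′ * (r * r + 1) + t′ * (r * r + 1) + ((SD + r * S₁) + (r * S₁ + SD) + (r * 1 + r * 1))) →
  S₁ + S₁ ≡ r * r + r → SD * 6 + 4 * r ≡ r * r * r + 3 * (r * r) → C₃ * 6 + 3 * (r * r) ≡ r * r * r + 2 * r →
  W + 4 * C₃ ≡ 2 * (n C 2) + q ^ 2 * n
-- Multiplying by 6 clears the denominators hidden in SD and C₃.
WienerD-arithmetic s′ t′ q n W SD S₁ C₃ refl hW hS₁ hSD hC₃ = *-cancelˡ-≡ _ _ 6 (+-cancelʳ-≡ K _ _ (begin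
  6 * (W + 4 * C₃) + K
    ≡⟨ isolate W C₃ n r ⟩
  6 * (W + n) + 4 * (C₃ * 6 + 3 * (r * r)) + 8 * r
    ≡⟨ cong₂ (λ x y → 6 * x + 4 * y + 8 * r) hW hC₃ ⟩
  6 * (X + (Y + ((SD + r * S₁) + (r * S₁ + SD) + (r * 1 + r * 1)))) + 4 * (r * r * r + 2 * r) + 8 * r
    ≡⟨ separate X Y SD S₁ r ⟩
  6 * P + 6 * (r * 1 + r * 1) + 2 * (SD * 6 + 4 * r) + 6 * r * (S₁ + S₁) + 4 * (r * r * r + 2 * r)
    ≡⟨ cong₂ (λ x y → 6 * P + 6 * (r * 1 + r * 1) + 2 * x + 6 * r * y + 4 * (r * r * r + 2 * r)) hSD hS₁ ⟩
  6 * P + 6 * (r * 1 + r * 1) + 2 * (r * r * r + 3 * (r * r)) + 6 * r * (r * r + r) + 4 * (r * r * r + 2 * r)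
    ≡⟨ polynomial s′ t′ q ⟩
  6 * (n * n) + 6 * (q ^ 2 * n) + 12 * (r * r) + 8 * r
    ≡⟨ cong (λ x → 6 * x + 6 * (q ^ 2 * n) + 12 * (r * r) + 8 * r) (sym (C2-double n)) ⟩
  6 * (n C 2 + n C 2 + n) + 6 * (q ^ 2 * n) + 12 * (r * r) + 8 * r
    ≡⟨ collect (n C 2) (q ^ 2 * n) n r ⟩
  6 * (2 * (n C 2) + q ^ 2 * n) + K ∎))
  where
  open ≡-Reasoning
  r = suc q
  K = 6 * n + 12 * (r * r) + 8 * r
  X = s′ * n + t′ * n
  Y = s′ * (r * r + 1) + t′ * (r * r + 1)
  P = X + Y
  isolate : ∀ W C n r → 6 * (W + 4 * C) + (6 * n + 12 * (r * r) + 8 * r) ≡ 6 * (W + n) + 4 * (C * 6 + 3 * (r * r)) + 8 * r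
  isolate = solve-∀
  separate : ∀ X Y SD S r → 6 * (X + (Y + ((SD + r * S) + (r * S + SD) + (r * 1 + r * 1)))) + 4 * (r * r * r + 2 * r) + 8 * r
                          ≡ 6 * (X + Y) + 6 * (r * 1 + r * 1) + 2 * (SD * 6 + 4 * r) + 6 * r * (S + S) + 4 * (r * r * r + 2 * r)
  separate = solve-∀
  polynomial : ∀ s′ t′ q →
    6 * (s′ * (suc s′ + suc t′ + (q + q)) + t′ * (suc s′ + suc t′ + (q + q)) + (s′ * (suc q * suc q + 1) + t′ * (suc q * suc q + 1))) + 6 * (suc q * 1 + suc q * 1)
      + 2 * (suc q * suc q * suc q + 3 * (suc q * suc q)) + 6 * suc q * (suc q * suc q + suc q) + 4 * (suc q * suc q * suc q + 2 * suc q)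
      ≡ 6 * ((suc s′ + suc t′ + (q + q)) * (suc s′ + suc t′ + (q + q))) + 6 * (q * (q * 1) * (suc s′ + suc t′ + (q + q))) + 12 * (suc q * suc q) + 8 * suc q
  polynomial = solve-∀
  collect : ∀ c b n r → 6 * (c + c + n) + 6 * b + 12 * (r * r) + 8 * r ≡ 6 * (2 * c + b) + (6 * n + 12 * (r * r) + 8 * r)
  collect = solve-∀

2r∸2 : ∀ q → 2 * suc q ∸ 2 ≡ q + q
2r∸2 q = trans (cong (λ x → x ∸ 1) (+-suc q (q + 0))) (cong (q +_) (+-identityʳ q))

lemma1 : (n r s : ℕ) → 2 ≤ r → 2 * r ≤ n → 1 ≤ s → 2 * s ≤ n + 2 ∸ 2 * r →
    (WienerG (G n r s) + r * (r ∸ 1) ^ 2 ≡ n C 2 + (r ∸ 1) ^ 2 * n)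
    × (WienerD (D n r s) + 4 * (r C 3) ≡ 2 * (n C 2) + (r ∸ 1) ^ 2 * n)
lemma1 n r@(suc (suc p)) s@(suc s′) r≥2 2r≤n _ 2s≤m =
  WienerG-arithmetic s′ t′ q n _ (sym size′)
    (GBlowup.WienerG-G n r s′ t′ r≥2 t-eq (trans (cong (s + suc t′ +_) (2r∸2 q)) size′)) ,
  WienerD-arithmetic s′ t′ q n _ (sideDistTotal r) (∑ r suc) (r C 3) (sym size′) (DBlowup.WienerD-D n q s′ t′ t-eq size′)
    (∑-suc-double r) (sideDistTotal-closed r) (C3-closed r)
  where
  q = suc p
  t = cliqueSize₂ n r s
  sizes = cliqueSizes n q s 2r≤n 2s≤m
  t′ = pred t
  t-eq : t ≡ suc t′
  t-eq = sym (suc-pred-positive (≤-trans (s≤s z≤n) (proj₁ sizes)))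
    where
    suc-pred-positive : ∀ {m} → 1 ≤ m → suc (pred m) ≡ m
    suc-pred-positive (s≤s _) = refl
  size′ : s + suc t′ + (q + q) ≡ n
  size′ = trans (cong (λ x → s + x + (q + q)) (sym t-eq)) (proj₂ sizes)
lemma1 _ (suc (suc _)) zero _ _ () _
lemma1 _ 1 _ (s≤s ()) _ _ _
lemma1 _ 0 _ () _ _ _
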